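{- Let $k\ge12$ be even, $m=\frac{k-4}{2}$, and for each odd $n\ge3$ let $f_n\in\mathfrak{ds}_n$ be a fixed element of depth $1$ with $(f_n\mid x^{n-1}y)=1$. For $1\le i,j\le m$ let $w_i=x^{2i}yx^{k-2i-2}y$, $g_j=f_{2j+1}f_{k-2j-1}+D_{f_{2j+1}}(f_{k-2j-1})$, and $A_{ij}=(g_j\mid w_i)$. Define $m\times m$ matrices $D$ and $B$ by $D^{ -1}=\mathrm{diag}\big(\binom{k-2}{2i}\big)_{1\le i\le m}$ and $B_{ij}=\binom{2j}{2i}$. Then ${}^tA\,D\,B$ is symmetric.
   Context: $\mathbb{Q}\langle x,y\rangle$ is the free associative algebra on non-commuting $x,y$ and $\mathrm{Lie}[x,y]$ the free Lie algebra inside it; $(f\mid w)$ is the coefficient of the word $w$ in $f$. With $y_i=x^{i-1}y$, the stuffle product of words ending in $y$ is given by $1*w=w*1=w$, $y_iw*y_jw'=y_i(w*y_jw')+y_j(y_iw*w')+y_{i+j}(w*w')$. $\mathfrak{ds}=\{f\in\mathrm{Lie}_{\ge3}[x,y]:(f\mid u*v)=0$ for all nonempty words $u,v$ ending in $y$, not both powers of $y\}$; $\mathfrak{ds}_n$ is its homogeneous degree-$n$ part. The depth of a polynomial is the minimal number of $y$'s in a monomial with nonzero coefficient. $D_f$ is the derivation of $\mathbb{Q}\langle x,y\rangle$ with $D_f(x)=0$, $D_f(y)=[y,f]$. ${}^tA$ denotes the transpose. -}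

module Defs where

open import Data.Nat as ℕ using (ℕ; zero; suc; _+_; _∸_; _≤_; _<_)
open import Data.Nat.Combinatorics using (_C_)
open import Data.Integer using (+_)
open import Data.Rational as ℚ using (ℚ; 0ℚ; 1ℚ; _/_)
open import Data.Fin using (Fin; toℕ)
open import Data.List using (List; []; _∷_; [_]; _++_; map; concatMap; replicate; length; foldr; filter)
open import Data.List.Properties using (≡-dec)
open import Data.List.Relation.Unary.All using (All)
open import Data.Product using (_×_; _,_; Σ; ∃)
open import Relation.Binary.PropositionalEquality using (_≡_; _≢_; refl)
open import Relation.Nullary using (yes; no; ¬_)
open import Relation.Binary.Definitions using (DecidableEquality)

data Letter : Set where
  X Y : Letter

_≟L_ : DecidableEquality Letter
X ≟L X = yes refl
X ≟L Y = no λ ()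
Y ≟L X = no λ ()
Y ≟L Y = yes refl

Word : Set
Word = List Letter

_≟W_ : DecidableEquality Word
_≟W_ = ≡-dec _≟L_

countY : Word → ℕ
countY [] = 0
countY (X ∷ w) = countY w
countY (Y ∷ w) = suc (countY w)

-- Elements of ℚ⟨x,y⟩, represented as finite formal sums Σ c·w.
-- Two representations denote the same polynomial iff all coefficients agree.

Poly : Set
Poly = List (ℚ × Word)

coeff : Poly → Word → ℚ
coeff [] w = 0ℚ
coeff ((c , v) ∷ f) w with v ≟W w
... | yes _ = c ℚ.+ coeff f w
... | no  _ = coeff f w

mono : Word → Poly
mono w = [ (1ℚ , w) ]

_⊕_ : Poly → Poly → Poly
f ⊕ g = f ++ g

_•_ : ℚ → Poly → Poly
c • f = map (λ { (d , w) → (c ℚ.* d , w) }) f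

_⊛_ : Poly → Poly → Poly
f ⊛ g = concatMap (λ { (c , v) → map (λ { (d , w) → (c ℚ.* d , v ++ w) }) g }) f

⟦_,_⟧ : Poly → Poly → Poly
⟦ f , g ⟧ = (f ⊛ g) ⊕ ((ℚ.- 1ℚ) • (g ⊛ f))

data IsLie : Poly → Set where
  lie-x   : IsLie (mono [ X ])
  lie-y   : IsLie (mono [ Y ])
  lie-add : ∀ {f g} → IsLie f → IsLie g → IsLie (f ⊕ g)
  lie-scl : ∀ {f} (c : ℚ) → IsLie f → IsLie (c • f)
  lie-brk : ∀ {f g} → IsLie f → IsLie g → IsLie ⟦ f , g ⟧
  lie-eq  : ∀ {f g} → IsLie f → (∀ w → coeff f w ≡ coeff g w) → IsLie g

Homogeneous : ℕ → Poly → Set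
Homogeneous n f = ∀ w → coeff f w ≢ 0ℚ → length w ≡ n

HasDepth : ℕ → Poly → Set
HasDepth d f =
  (∃ λ w → coeff f w ≢ 0ℚ × countY w ≡ d) ×
  (∀ w → coeff f w ≢ 0ℚ → d ≤ countY w)

-- A word ending in y is y_{i₁} ⋯ y_{iᵣ} with y_i = x^{i-1} y;
-- we encode it by its list of indices (i₁ , … , iᵣ), all iₗ ≥ 1.
-- The stuffle product is returned as a list of words (with multiplicity).

_*s_ : List ℕ → List ℕ → List (List ℕ)
[] *s v = [ v ]
(i ∷ u) *s [] = [ i ∷ u ]
(i ∷ u) *s (j ∷ v) =
  map (i ∷_) (u *s (j ∷ v)) ++
  map (j ∷_) ((i ∷ u) *s v) ++
  map ((i + j) ∷_) (u *s v)

toWord : List ℕ → Word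
toWord [] = []
toWord (i ∷ u) = replicate (i ∸ 1) X ++ Y ∷ toWord u

coeffStuffle : Poly → List ℕ → List ℕ → ℚ
coeffStuffle f u v = foldr (λ w acc → coeff f (toWord w) ℚ.+ acc) 0ℚ (u *s v)

NonEmpty : List ℕ → Set
NonEmpty u = u ≢ []

PowerOfY : List ℕ → Set
PowerOfY u = All (_≡ 1) u

InDs : ℕ → Poly → Set
InDs n f =
  IsLie f × Homogeneous n f × 3 ≤ n ×
  (∀ (u v : List ℕ) → All (0 <_) u → All (0 <_) v →
     NonEmpty u → NonEmpty v → ¬ (PowerOfY u × PowerOfY v) →
     coeffStuffle f u v ≡ 0ℚ)

Dword : Poly → Word → Poly
Dword f [] = []
Dword f (X ∷ w) = mono [ X ] ⊛ Dword f w
Dword f (Y ∷ w) = (⟦ mono [ Y ] , f ⟧ ⊛ mono w) ⊕ (mono [ Y ] ⊛ Dword f w)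

Der : Poly → Poly → Poly
Der f g = concatMap (λ { (c , w) → c • Dword f w }) g

Matrix : ℕ → Set
Matrix m = Fin m → Fin m → ℚ

ΣF : ∀ {m} → (Fin m → ℚ) → ℚ
ΣF {zero} h = 0ℚ
ΣF {suc m} h = h Fin.zero ℚ.+ ΣF (λ i → h (Fin.suc i))

_·M_ : ∀ {m} → Matrix m → Matrix m → Matrix m
(P ·M Q) i j = ΣF (λ l → P i l ℚ.* Q l j)

transpose : ∀ {m} → Matrix m → Matrix m
transpose P i j = P j i

identity : ∀ {m} → Matrix m
identity i j with toℕ i ℕ.≟ toℕ j
... | yes _ = 1ℚ
... | no  _ = 0ℚ

diag : ∀ {m} → (Fin m → ℚ) → Matrix m
diag d i j with toℕ i ℕ.≟ toℕ j
... | yes _ = d i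
... | no  _ = 0ℚ

IsSymmetric : ∀ {m} → Matrix m → Set
IsSymmetric P = ∀ i j → P i j ≡ P j i

ℕtoℚ : ℕ → ℚ
ℕtoℚ n = (+ n) / 1

-- Data of the proposition (indices i, j ∈ {1,…,m} are encoded by Fin m,
-- with i = toℕ i' + 1).

w : ℕ → ℕ → Word
w k i = replicate (2 ℕ.* i) X ++ Y ∷ replicate (k ∸ 2 ℕ.* i ∸ 2) X ++ [ Y ]

g : (ℕ → Poly) → ℕ → ℕ → Poly
g f k j = (f (2 ℕ.* j + 1) ⊛ f (k ∸ 2 ℕ.* j ∸ 1)) ⊕ Der (f (2 ℕ.* j + 1)) (f (k ∸ 2 ℕ.* j ∸ 1))

matA : (ℕ → Poly) → (k m : ℕ) → Matrix m
matA f k m i j = coeff (g f k (suc (toℕ j))) (w k (suc (toℕ i)))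

matDinv : (k m : ℕ) → Matrix m
matDinv k m = diag (λ i → ℕtoℚ ((k ∸ 2) C (2 ℕ.* suc (toℕ i))))

matB : (m : ℕ) → Matrix m
matB m i j = ℕtoℚ ((2 ℕ.* suc (toℕ j)) C (2 ℕ.* suc (toℕ i)))

xpowy : ℕ → Word
xpowy n = replicate (n ∸ 1) X ++ [ Y ]

-- Only words with one or two y's matter. In depth one a Lie element is a combination of the
-- ad(x)^n(y) = Σ_b (-1)^b binom(n,b) x^(n-b) y x^b, so (f ∣ x^a y x^b) = (-1)^b binom(a+b,b) (f ∣ x^(a+b) y).
-- Reading g_j = f_(2j+1) f_(k-2j-1) + D_(f_(2j+1))(f_(k-2j-1)) off the word w_i with this rule gives
-- A_ij = binom(2j,2i) + δ(2i, k-2j-2) - binom(2j, k-2-2i). Accordingly (ᵗA D B)_ij splits into three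
-- sums over l: the first is visibly symmetric, the δ-sum reduces to the trinomial identity
-- binom(N,2j) binom(2j,N-2i) = binom(N,2i) binom(2i,N-2j) with N = k-2, and the last becomes symmetric
-- after the reflection l ↦ N/2 - l, which leaves the diagonal of D invariant.

module Submission where

open import Defs
open import Data.Nat as ℕ using (ℕ; zero; suc; _<_; _≤_; z≤n; s≤s; _∸_; _%_; _/_; _!)
open import Data.Nat.Properties as ℕP using (_!≢0; _!*_!≢0)
open import Data.Nat.DivMod using (m/n*n≡m; m≡m%n+[m/n]*n; [m+kn]%n≡m%n)
open import Data.Nat.Coprimality as Coprime using (Coprime)
open import Data.Nat.Combinatorics using (_C_; nCn≡1; nCk+nC[k+1]≡[n+1]C[k+1]; nCk≡nC[n∸k]; k![n∸k]!∣n!)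
open import Data.Nat.Combinatorics.Specification using (k>n⇒nCk≡0; nCk≡n!/k![n-k]!)
open import Data.Nat.Tactic.RingSolver using (solve-∀)
open import Data.Integer as ℤ using ()
open import Data.Integer.Properties as ℤP using ()
open import Data.Sign as Sign using ()
open import Data.Rational as ℚ using (ℚ; 0ℚ; 1ℚ; _+_; _*_; -_)
open import Data.Rational.Properties as ℚP
  using (+-identityˡ; +-identityʳ; *-zeroˡ; *-zeroʳ; *-identityˡ; *-identityʳ)
open import Data.Rational.Solver using (module +-*-Solver)
open +-*-Solver using (solve; _:=_; _:+_; _:*_; con)
open import Data.Fin as Fin using (Fin; toℕ)
open import Data.Fin.Properties as FinP using (toℕ-injective; toℕ<n)
open import Data.List using ([]; _∷_; [_]; _++_; map; replicate; length)
open import Data.List.Properties using (∷-injectiveˡ; ∷-injectiveʳ; length-++; length-replicate; ++-assoc)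
open import Data.Product using (_×_; _,_; proj₁; proj₂)
open import Data.Empty using (⊥-elim)
open import Relation.Nullary using (yes; no; ¬_; Dec)
open import Relation.Binary.Definitions using (tri<; tri≈; tri>)
open import Relation.Binary.PropositionalEquality
  using (_≡_; _≢_; refl; sym; trans; cong; cong₂; subst; module ≡-Reasoning)

coeffTerm : ℚ → Word → Word → ℚ
coeffTerm c v w with v ≟W w
... | yes _ = c
... | no _  = 0ℚ

coeff-∷ : ∀ c v p w → coeff ((c , v) ∷ p) w ≡ coeffTerm c v w + coeff p w
coeff-∷ c v p w with v ≟W w
... | yes _ = refl
... | no _  = sym (+-identityˡ _)

coeffTerm-refl : ∀ c v → coeffTerm c v v ≡ c
coeffTerm-refl c v with v ≟W v
... | yes _ = refl
... | no v≢v = ⊥-elim (v≢v refl)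

coeffTerm-≢ : ∀ c v w → v ≢ w → coeffTerm c v w ≡ 0ℚ
coeffTerm-≢ c v w v≢w with v ≟W w
... | yes v≡w = ⊥-elim (v≢w v≡w)
... | no _    = refl

coeffTerm-∷-≢ : ∀ c {ℓ ℓ′} v w → ℓ′ ≢ ℓ → coeffTerm c (ℓ′ ∷ v) (ℓ ∷ w) ≡ 0ℚ
coeffTerm-∷-≢ c v w ℓ′≢ℓ = coeffTerm-≢ c _ _ (λ e → ℓ′≢ℓ (∷-injectiveˡ e))

coeffTerm-∷ : ∀ c ℓ v w → coeffTerm c (ℓ ∷ v) (ℓ ∷ w) ≡ coeffTerm c v w
coeffTerm-∷ c ℓ v w = by-cases (v ≟W w)
  where
  by-cases : Dec (v ≡ w) → coeffTerm c (ℓ ∷ v) (ℓ ∷ w) ≡ coeffTerm c v w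
  by-cases (yes refl) = trans (coeffTerm-refl c (ℓ ∷ v)) (sym (coeffTerm-refl c v))
  by-cases (no v≢w)   = trans (coeffTerm-≢ c (ℓ ∷ v) (ℓ ∷ w) (λ e → v≢w (∷-injectiveʳ e))) (sym (coeffTerm-≢ c v w v≢w))

coeffTerm-* : ∀ c d v w → coeffTerm (c * d) v w ≡ c * coeffTerm d v w
coeffTerm-* c d v w with v ≟W w
... | yes _ = refl
... | no _  = sym (*-zeroʳ c)

coeff-++ : ∀ p q w → coeff (p ++ q) w ≡ coeff p w + coeff q w
coeff-++ [] q w = sym (+-identityˡ _)
coeff-++ ((c , v) ∷ p) q w = begin
  coeff ((c , v) ∷ (p ++ q)) w                ≡⟨ coeff-∷ c v (p ++ q) w ⟩
  coeffTerm c v w + coeff (p ++ q) w          ≡⟨ cong (coeffTerm c v w +_) (coeff-++ p q w) ⟩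
  coeffTerm c v w + (coeff p w + coeff q w)   ≡⟨ ℚP.+-assoc (coeffTerm c v w) _ _ ⟨
  (coeffTerm c v w + coeff p w) + coeff q w   ≡⟨ cong (_+ coeff q w) (coeff-∷ c v p w) ⟨
  coeff ((c , v) ∷ p) w + coeff q w           ∎
  where open ≡-Reasoning

coeff-mono : ∀ u w → coeff (mono u) w ≡ coeffTerm 1ℚ u w
coeff-mono u w = trans (coeff-∷ 1ℚ u [] w) (+-identityʳ _)

coeff-• : ∀ c p w → coeff (c • p) w ≡ c * coeff p w
coeff-• c [] w = sym (*-zeroʳ c)
coeff-• c ((d , v) ∷ p) w = begin
  coeff ((c * d , v) ∷ (c • p)) w              ≡⟨ coeff-∷ (c * d) v (c • p) w ⟩
  coeffTerm (c * d) v w + coeff (c • p) w      ≡⟨ cong₂ _+_ (coeffTerm-* c d v w) (coeff-• c p w) ⟩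
  c * coeffTerm d v w + c * coeff p w          ≡⟨ ℚP.*-distribˡ-+ c _ _ ⟨
  c * (coeffTerm d v w + coeff p w)            ≡⟨ cong (c *_) (coeff-∷ d v p w) ⟨
  c * coeff ((d , v) ∷ p) w                    ∎
  where open ≡-Reasoning

∂ : Letter → Poly → Poly
∂ ℓ [] = []
∂ ℓ ((c , []) ∷ p) = ∂ ℓ p
∂ X ((c , X ∷ v) ∷ p) = (c , v) ∷ ∂ X p
∂ X ((c , Y ∷ v) ∷ p) = ∂ X p
∂ Y ((c , X ∷ v) ∷ p) = ∂ Y p
∂ Y ((c , Y ∷ v) ∷ p) = (c , v) ∷ ∂ Y p

module _ (ℓ : Letter) (c : ℚ) (v : Word) (p : Poly) where

  coeff-∂-match : (∀ w → coeff (∂ ℓ p) w ≡ coeff p (ℓ ∷ w)) →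
                  ∀ w → coeff ((c , v) ∷ ∂ ℓ p) w ≡ coeff ((c , ℓ ∷ v) ∷ p) (ℓ ∷ w)
  coeff-∂-match ih w = begin
    coeff ((c , v) ∷ ∂ ℓ p) w                       ≡⟨ coeff-∷ c v (∂ ℓ p) w ⟩
    coeffTerm c v w + coeff (∂ ℓ p) w               ≡⟨ cong₂ _+_ (coeffTerm-∷ c ℓ v w) (sym (ih w)) ⟨
    coeffTerm c (ℓ ∷ v) (ℓ ∷ w) + coeff p (ℓ ∷ w)   ≡⟨ coeff-∷ c (ℓ ∷ v) p (ℓ ∷ w) ⟨
    coeff ((c , ℓ ∷ v) ∷ p) (ℓ ∷ w)                 ∎
    where open ≡-Reasoning

  coeff-∂-mismatch : ∀ ℓ′ → ℓ′ ≢ ℓ → (∀ w → coeff (∂ ℓ p) w ≡ coeff p (ℓ ∷ w)) →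
                     ∀ w → coeff (∂ ℓ p) w ≡ coeff ((c , ℓ′ ∷ v) ∷ p) (ℓ ∷ w)
  coeff-∂-mismatch ℓ′ ℓ′≢ℓ ih w = begin
    coeff (∂ ℓ p) w                                 ≡⟨ ih w ⟩
    coeff p (ℓ ∷ w)                                 ≡⟨ +-identityˡ _ ⟨
    0ℚ + coeff p (ℓ ∷ w)                            ≡⟨ cong (_+ coeff p (ℓ ∷ w)) (coeffTerm-∷-≢ c v w ℓ′≢ℓ) ⟨
    coeffTerm c (ℓ′ ∷ v) (ℓ ∷ w) + coeff p (ℓ ∷ w)  ≡⟨ coeff-∷ c (ℓ′ ∷ v) p (ℓ ∷ w) ⟨
    coeff ((c , ℓ′ ∷ v) ∷ p) (ℓ ∷ w)                ∎
    where open ≡-Reasoning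

coeff-∂ : ∀ ℓ p w → coeff (∂ ℓ p) w ≡ coeff p (ℓ ∷ w)
coeff-∂ ℓ [] w = refl
coeff-∂ ℓ ((c , []) ∷ p) w = coeff-∂ ℓ p w
coeff-∂ X ((c , X ∷ v) ∷ p) = coeff-∂-match X c v p (coeff-∂ X p)
coeff-∂ X ((c , Y ∷ v) ∷ p) = coeff-∂-mismatch X c v p Y (λ ()) (coeff-∂ X p)
coeff-∂ Y ((c , X ∷ v) ∷ p) = coeff-∂-mismatch Y c v p X (λ ()) (coeff-∂ Y p)
coeff-∂ Y ((c , Y ∷ v) ∷ p) = coeff-∂-match Y c v p (coeff-∂ Y p)

-- The Leibniz rule for the left derivative

termMul : ℚ → Word → Poly → Poly
termMul c v [] = []
termMul c v ((d , u) ∷ q) = (c * d , v ++ u) ∷ termMul c v q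

⊛-∷ˡ : ∀ c v p q → ((c , v) ∷ p) ⊛ q ≡ termMul c v q ++ (p ⊛ q)
⊛-∷ˡ c v p q = cong (_++ (p ⊛ q)) (map-termMul q)
  where
  map-termMul : ∀ q → map (λ { (d , u) → (c * d , v ++ u) }) q ≡ termMul c v q
  map-termMul [] = refl
  map-termMul ((d , u) ∷ q) = cong ((c * d , v ++ u) ∷_) (map-termMul q)

coeff-⊛-∷ˡ : ∀ c v p q w → coeff (((c , v) ∷ p) ⊛ q) w ≡ coeff (termMul c v q) w + coeff (p ⊛ q) w
coeff-⊛-∷ˡ c v p q w = trans (cong (λ r → coeff r w) (⊛-∷ˡ c v p q)) (coeff-++ (termMul c v q) (p ⊛ q) w)

coeff-termMul-[] : ∀ c q w → coeff (termMul c [] q) w ≡ c * coeff q w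
coeff-termMul-[] c [] w = sym (*-zeroʳ c)
coeff-termMul-[] c ((d , u) ∷ q) w = begin
  coeff ((c * d , u) ∷ termMul c [] q) w            ≡⟨ coeff-∷ (c * d) u (termMul c [] q) w ⟩
  coeffTerm (c * d) u w + coeff (termMul c [] q) w  ≡⟨ cong₂ _+_ (coeffTerm-* c d u w) (coeff-termMul-[] c q w) ⟩
  c * coeffTerm d u w + c * coeff q w               ≡⟨ ℚP.*-distribˡ-+ c _ _ ⟨
  c * (coeffTerm d u w + coeff q w)                 ≡⟨ cong (c *_) (coeff-∷ d u q w) ⟨
  c * coeff ((d , u) ∷ q) w                         ∎
  where open ≡-Reasoning

coeff-termMul-∷ : ∀ c ℓ v q w → coeff (termMul c (ℓ ∷ v) q) (ℓ ∷ w) ≡ coeff (termMul c v q) w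
coeff-termMul-∷ c ℓ v [] w = refl
coeff-termMul-∷ c ℓ v ((d , u) ∷ q) w = begin
  coeff ((c * d , ℓ ∷ v ++ u) ∷ termMul c (ℓ ∷ v) q) (ℓ ∷ w)
    ≡⟨ coeff-∷ (c * d) (ℓ ∷ v ++ u) (termMul c (ℓ ∷ v) q) (ℓ ∷ w) ⟩
  coeffTerm (c * d) (ℓ ∷ v ++ u) (ℓ ∷ w) + coeff (termMul c (ℓ ∷ v) q) (ℓ ∷ w)
    ≡⟨ cong₂ _+_ (coeffTerm-∷ (c * d) ℓ (v ++ u) w) (coeff-termMul-∷ c ℓ v q w) ⟩
  coeffTerm (c * d) (v ++ u) w + coeff (termMul c v q) w
    ≡⟨ coeff-∷ (c * d) (v ++ u) (termMul c v q) w ⟨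
  coeff ((c * d , v ++ u) ∷ termMul c v q) w
    ∎
  where open ≡-Reasoning

coeff-termMul-≢ : ∀ c {ℓ ℓ′} v q w → ℓ′ ≢ ℓ → coeff (termMul c (ℓ′ ∷ v) q) (ℓ ∷ w) ≡ 0ℚ
coeff-termMul-≢ c v [] w ℓ′≢ℓ = refl
coeff-termMul-≢ c {ℓ} {ℓ′} v ((d , u) ∷ q) w ℓ′≢ℓ = begin
  coeff ((c * d , ℓ′ ∷ v ++ u) ∷ termMul c (ℓ′ ∷ v) q) (ℓ ∷ w)
    ≡⟨ coeff-∷ (c * d) (ℓ′ ∷ v ++ u) (termMul c (ℓ′ ∷ v) q) (ℓ ∷ w) ⟩
  coeffTerm (c * d) (ℓ′ ∷ v ++ u) (ℓ ∷ w) + coeff (termMul c (ℓ′ ∷ v) q) (ℓ ∷ w)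
    ≡⟨ cong₂ _+_ (coeffTerm-∷-≢ (c * d) (v ++ u) w ℓ′≢ℓ) (coeff-termMul-≢ c v q w ℓ′≢ℓ) ⟩
  0ℚ + 0ℚ
    ∎
  where open ≡-Reasoning

coeff-termMul-∷-[] : ∀ c ℓ v q → coeff (termMul c (ℓ ∷ v) q) [] ≡ 0ℚ
coeff-termMul-∷-[] c ℓ v [] = refl
coeff-termMul-∷-[] c ℓ v ((d , u) ∷ q) = coeff-termMul-∷-[] c ℓ v q

coeff-⊛-[] : ∀ p q → coeff (p ⊛ q) [] ≡ coeff p [] * coeff q []
coeff-⊛-[] [] q = sym (*-zeroˡ (coeff q []))
coeff-⊛-[] ((c , []) ∷ p) q = begin
  coeff (((c , []) ∷ p) ⊛ q) []                  ≡⟨ coeff-⊛-∷ˡ c [] p q [] ⟩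
  coeff (termMul c [] q) [] + coeff (p ⊛ q) []   ≡⟨ cong₂ _+_ (coeff-termMul-[] c q []) (coeff-⊛-[] p q) ⟩
  c * coeff q [] + coeff p [] * coeff q []       ≡⟨ ℚP.*-distribʳ-+ _ c _ ⟨
  (c + coeff p []) * coeff q []                  ≡⟨ cong (_* coeff q []) (coeff-∷ c [] p []) ⟨
  coeff ((c , []) ∷ p) [] * coeff q []           ∎
  where open ≡-Reasoning
coeff-⊛-[] ((c , ℓ ∷ v) ∷ p) q = begin
  coeff (((c , ℓ ∷ v) ∷ p) ⊛ q) []                 ≡⟨ coeff-⊛-∷ˡ c (ℓ ∷ v) p q [] ⟩
  coeff (termMul c (ℓ ∷ v) q) [] + coeff (p ⊛ q) [] ≡⟨ cong₂ _+_ (coeff-termMul-∷-[] c ℓ v q) (coeff-⊛-[] p q) ⟩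
  0ℚ + coeff p [] * coeff q []                     ≡⟨ +-identityˡ _ ⟩
  coeff ((c , ℓ ∷ v) ∷ p) [] * coeff q []          ∎
  where open ≡-Reasoning

LeibnizAt : Letter → Poly → Poly → Word → Set
LeibnizAt ℓ p q w = coeff (p ⊛ q) (ℓ ∷ w) ≡ coeff p [] * coeff q (ℓ ∷ w) + coeff (∂ ℓ p ⊛ q) w

module _ (ℓ : Letter) (c : ℚ) (p q : Poly) (w : Word) (ih : LeibnizAt ℓ p q w) where
  private
    P = coeff p []
    A = coeff q (ℓ ∷ w)
    B = coeff (∂ ℓ p ⊛ q) w

  coeff-⊛-∷-empty : LeibnizAt ℓ ((c , []) ∷ p) q w
  coeff-⊛-∷-empty = begin
    coeff (((c , []) ∷ p) ⊛ q) (ℓ ∷ w)                    ≡⟨ coeff-⊛-∷ˡ c [] p q (ℓ ∷ w) ⟩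
    coeff (termMul c [] q) (ℓ ∷ w) + coeff (p ⊛ q) (ℓ ∷ w) ≡⟨ cong₂ _+_ (coeff-termMul-[] c q (ℓ ∷ w)) ih ⟩
    c * A + (P * A + B)                                   ≡⟨ solve 4 (λ c A P B → c :* A :+ (P :* A :+ B) := (c :+ P) :* A :+ B) refl c A P B ⟩
    (c + P) * A + B                                       ≡⟨ cong (λ z → z * A + B) (coeff-∷ c [] p []) ⟨
    coeff ((c , []) ∷ p) [] * A + B                       ∎
    where open ≡-Reasoning

  coeff-⊛-∷-match : ∀ v → coeff (((c , ℓ ∷ v) ∷ p) ⊛ q) (ℓ ∷ w) ≡ P * A + coeff (((c , v) ∷ ∂ ℓ p) ⊛ q) w
  coeff-⊛-∷-match v = begin
    coeff (((c , ℓ ∷ v) ∷ p) ⊛ q) (ℓ ∷ w)                        ≡⟨ coeff-⊛-∷ˡ c (ℓ ∷ v) p q (ℓ ∷ w) ⟩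
    coeff (termMul c (ℓ ∷ v) q) (ℓ ∷ w) + coeff (p ⊛ q) (ℓ ∷ w)  ≡⟨ cong₂ _+_ (coeff-termMul-∷ c ℓ v q w) ih ⟩
    T + (P * A + B)                                              ≡⟨ solve 4 (λ T P A B → T :+ (P :* A :+ B) := P :* A :+ (T :+ B)) refl T P A B ⟩
    P * A + (T + B)                                              ≡⟨ cong (P * A +_) (coeff-⊛-∷ˡ c v (∂ ℓ p) q w) ⟨
    P * A + coeff (((c , v) ∷ ∂ ℓ p) ⊛ q) w                      ∎
    where
    open ≡-Reasoning
    T = coeff (termMul c v q) w

  coeff-⊛-∷-mismatch : ∀ ℓ′ v → ℓ′ ≢ ℓ → coeff (((c , ℓ′ ∷ v) ∷ p) ⊛ q) (ℓ ∷ w) ≡ P * A + B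
  coeff-⊛-∷-mismatch ℓ′ v ℓ′≢ℓ = begin
    coeff (((c , ℓ′ ∷ v) ∷ p) ⊛ q) (ℓ ∷ w)                        ≡⟨ coeff-⊛-∷ˡ c (ℓ′ ∷ v) p q (ℓ ∷ w) ⟩
    coeff (termMul c (ℓ′ ∷ v) q) (ℓ ∷ w) + coeff (p ⊛ q) (ℓ ∷ w)  ≡⟨ cong₂ _+_ (coeff-termMul-≢ c v q w ℓ′≢ℓ) ih ⟩
    0ℚ + (P * A + B)                                              ≡⟨ +-identityˡ _ ⟩
    P * A + B                                                     ∎
    where open ≡-Reasoning

coeff-⊛-∷ : ∀ p q ℓ w → LeibnizAt ℓ p q w
coeff-⊛-∷ [] q ℓ w = sym (trans (cong (_+ 0ℚ) (*-zeroˡ (coeff q (ℓ ∷ w)))) (+-identityʳ 0ℚ))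
coeff-⊛-∷ ((c , []) ∷ p) q ℓ w = coeff-⊛-∷-empty ℓ c p q w (coeff-⊛-∷ p q ℓ w)
coeff-⊛-∷ ((c , X ∷ v) ∷ p) q X w = coeff-⊛-∷-match X c p q w (coeff-⊛-∷ p q X w) v
coeff-⊛-∷ ((c , Y ∷ v) ∷ p) q X w = coeff-⊛-∷-mismatch X c p q w (coeff-⊛-∷ p q X w) Y v (λ ())
coeff-⊛-∷ ((c , X ∷ v) ∷ p) q Y w = coeff-⊛-∷-mismatch Y c p q w (coeff-⊛-∷ p q Y w) X v (λ ())
coeff-⊛-∷ ((c , Y ∷ v) ∷ p) q Y w = coeff-⊛-∷-match Y c p q w (coeff-⊛-∷ p q Y w) v

_≈ᶜ_ : Poly → Poly → Set
p ≈ᶜ q = ∀ w → coeff p w ≡ coeff q w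

⊛-congˡ : ∀ p p′ → p ≈ᶜ p′ → ∀ q → (p ⊛ q) ≈ᶜ (p′ ⊛ q)
⊛-congˡ p p′ p≈p′ q [] = begin
  coeff (p ⊛ q) []         ≡⟨ coeff-⊛-[] p q ⟩
  coeff p [] * coeff q []  ≡⟨ cong (_* coeff q []) (p≈p′ []) ⟩
  coeff p′ [] * coeff q [] ≡⟨ coeff-⊛-[] p′ q ⟨
  coeff (p′ ⊛ q) []        ∎
  where open ≡-Reasoning
⊛-congˡ p p′ p≈p′ q (ℓ ∷ w) = begin
  coeff (p ⊛ q) (ℓ ∷ w)                                     ≡⟨ coeff-⊛-∷ p q ℓ w ⟩
  coeff p [] * coeff q (ℓ ∷ w) + coeff (∂ ℓ p ⊛ q) w
    ≡⟨ cong₂ _+_ (cong (_* coeff q (ℓ ∷ w)) (p≈p′ [])) (⊛-congˡ (∂ ℓ p) (∂ ℓ p′) ∂p≈∂p′ q w) ⟩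
  coeff p′ [] * coeff q (ℓ ∷ w) + coeff (∂ ℓ p′ ⊛ q) w      ≡⟨ coeff-⊛-∷ p′ q ℓ w ⟨
  coeff (p′ ⊛ q) (ℓ ∷ w)                                    ∎
  where
  open ≡-Reasoning
  ∂p≈∂p′ : ∂ ℓ p ≈ᶜ ∂ ℓ p′
  ∂p≈∂p′ u = trans (coeff-∂ ℓ p u) (trans (p≈p′ (ℓ ∷ u)) (sym (coeff-∂ ℓ p′ u)))

coeff-++-⊛ : ∀ p₁ p₂ q w → coeff ((p₁ ++ p₂) ⊛ q) w ≡ coeff (p₁ ⊛ q) w + coeff (p₂ ⊛ q) w
coeff-++-⊛ [] p₂ q w = sym (+-identityˡ _)
coeff-++-⊛ ((c , v) ∷ p₁) p₂ q w = begin
  coeff (((c , v) ∷ (p₁ ++ p₂)) ⊛ q) w                 ≡⟨ coeff-⊛-∷ˡ c v (p₁ ++ p₂) q w ⟩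
  T + coeff ((p₁ ++ p₂) ⊛ q) w                         ≡⟨ cong (T +_) (coeff-++-⊛ p₁ p₂ q w) ⟩
  T + (coeff (p₁ ⊛ q) w + coeff (p₂ ⊛ q) w)            ≡⟨ ℚP.+-assoc T _ _ ⟨
  (T + coeff (p₁ ⊛ q) w) + coeff (p₂ ⊛ q) w            ≡⟨ cong (_+ coeff (p₂ ⊛ q) w) (coeff-⊛-∷ˡ c v p₁ q w) ⟨
  coeff (((c , v) ∷ p₁) ⊛ q) w + coeff (p₂ ⊛ q) w      ∎
  where
  open ≡-Reasoning
  T = coeff (termMul c v q) w

coeff-termMul-* : ∀ c d v q w → coeff (termMul (c * d) v q) w ≡ c * coeff (termMul d v q) w
coeff-termMul-* c d v [] w = sym (*-zeroʳ c)
coeff-termMul-* c d v ((e , u) ∷ q) w = begin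
  coeff ((c * d * e , v ++ u) ∷ termMul (c * d) v q) w
    ≡⟨ coeff-∷ (c * d * e) (v ++ u) (termMul (c * d) v q) w ⟩
  coeffTerm (c * d * e) (v ++ u) w + coeff (termMul (c * d) v q) w
    ≡⟨ cong₂ _+_ (cong (λ z → coeffTerm z (v ++ u) w) (ℚP.*-assoc c d e)) (coeff-termMul-* c d v q w) ⟩
  coeffTerm (c * (d * e)) (v ++ u) w + c * coeff (termMul d v q) w
    ≡⟨ cong (_+ c * coeff (termMul d v q) w) (coeffTerm-* c (d * e) (v ++ u) w) ⟩
  c * coeffTerm (d * e) (v ++ u) w + c * coeff (termMul d v q) w
    ≡⟨ ℚP.*-distribˡ-+ c _ _ ⟨
  c * (coeffTerm (d * e) (v ++ u) w + coeff (termMul d v q) w)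
    ≡⟨ cong (c *_) (coeff-∷ (d * e) (v ++ u) (termMul d v q) w) ⟨
  c * coeff ((d * e , v ++ u) ∷ termMul d v q) w
    ∎
  where open ≡-Reasoning

coeff-•-⊛ : ∀ c p q w → coeff ((c • p) ⊛ q) w ≡ c * coeff (p ⊛ q) w
coeff-•-⊛ c [] q w = sym (*-zeroʳ c)
coeff-•-⊛ c ((d , v) ∷ p) q w = begin
  coeff (((c * d , v) ∷ (c • p)) ⊛ q) w                      ≡⟨ coeff-⊛-∷ˡ (c * d) v (c • p) q w ⟩
  coeff (termMul (c * d) v q) w + coeff ((c • p) ⊛ q) w      ≡⟨ cong₂ _+_ (coeff-termMul-* c d v q w) (coeff-•-⊛ c p q w) ⟩
  c * coeff (termMul d v q) w + c * coeff (p ⊛ q) w          ≡⟨ ℚP.*-distribˡ-+ c _ _ ⟨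
  c * (coeff (termMul d v q) w + coeff (p ⊛ q) w)            ≡⟨ cong (c *_) (coeff-⊛-∷ˡ d v p q w) ⟨
  c * coeff (((d , v) ∷ p) ⊛ q) w                            ∎
  where open ≡-Reasoning

∂-⊛ : ∀ ℓ p q → ∂ ℓ (p ⊛ q) ≈ᶜ ((coeff p [] • ∂ ℓ q) ++ (∂ ℓ p ⊛ q))
∂-⊛ ℓ p q u = begin
  coeff (∂ ℓ (p ⊛ q)) u                                    ≡⟨ coeff-∂ ℓ (p ⊛ q) u ⟩
  coeff (p ⊛ q) (ℓ ∷ u)                                    ≡⟨ coeff-⊛-∷ p q ℓ u ⟩
  coeff p [] * coeff q (ℓ ∷ u) + coeff (∂ ℓ p ⊛ q) u       ≡⟨ cong (λ z → coeff p [] * z + coeff (∂ ℓ p ⊛ q) u) (coeff-∂ ℓ q u) ⟨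
  coeff p [] * coeff (∂ ℓ q) u + coeff (∂ ℓ p ⊛ q) u       ≡⟨ cong (_+ coeff (∂ ℓ p ⊛ q) u) (coeff-• (coeff p []) (∂ ℓ q) u) ⟨
  coeff (coeff p [] • ∂ ℓ q) u + coeff (∂ ℓ p ⊛ q) u       ≡⟨ coeff-++ (coeff p [] • ∂ ℓ q) (∂ ℓ p ⊛ q) u ⟨
  coeff ((coeff p [] • ∂ ℓ q) ++ (∂ ℓ p ⊛ q)) u            ∎
  where open ≡-Reasoning

⊛-assoc : ∀ p q r → ((p ⊛ q) ⊛ r) ≈ᶜ (p ⊛ (q ⊛ r))
⊛-assoc p q r [] = begin
  coeff ((p ⊛ q) ⊛ r) []                     ≡⟨ coeff-⊛-[] (p ⊛ q) r ⟩
  coeff (p ⊛ q) [] * coeff r []              ≡⟨ cong (_* coeff r []) (coeff-⊛-[] p q) ⟩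
  coeff p [] * coeff q [] * coeff r []       ≡⟨ ℚP.*-assoc (coeff p []) _ _ ⟩
  coeff p [] * (coeff q [] * coeff r [])     ≡⟨ cong (coeff p [] *_) (coeff-⊛-[] q r) ⟨
  coeff p [] * coeff (q ⊛ r) []              ≡⟨ coeff-⊛-[] p (q ⊛ r) ⟨
  coeff (p ⊛ (q ⊛ r)) []                     ∎
  where open ≡-Reasoning
⊛-assoc p q r (ℓ ∷ w) = begin
  coeff ((p ⊛ q) ⊛ r) (ℓ ∷ w)
    ≡⟨ coeff-⊛-∷ (p ⊛ q) r ℓ w ⟩
  coeff (p ⊛ q) [] * R + coeff (∂ ℓ (p ⊛ q) ⊛ r) w
    ≡⟨ cong₂ _+_ (cong (_* R) (coeff-⊛-[] p q)) (⊛-congˡ (∂ ℓ (p ⊛ q)) ((P • ∂ ℓ q) ++ (∂ ℓ p ⊛ q)) (∂-⊛ ℓ p q) r w) ⟩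
  P * Q * R + coeff (((P • ∂ ℓ q) ++ (∂ ℓ p ⊛ q)) ⊛ r) w
    ≡⟨ cong (P * Q * R +_) (coeff-++-⊛ (P • ∂ ℓ q) (∂ ℓ p ⊛ q) r w) ⟩
  P * Q * R + (coeff ((P • ∂ ℓ q) ⊛ r) w + coeff ((∂ ℓ p ⊛ q) ⊛ r) w)
    ≡⟨ cong₂ (λ a b → P * Q * R + (a + b)) (coeff-•-⊛ P (∂ ℓ q) r w) (⊛-assoc (∂ ℓ p) q r w) ⟩
  P * Q * R + (P * U + V)
    ≡⟨ solve 5 (λ P Q R U V → P :* Q :* R :+ (P :* U :+ V) := P :* (Q :* R :+ U) :+ V) refl P Q R U V ⟩
  P * (Q * R + U) + V
    ≡⟨ cong (λ z → P * z + V) (coeff-⊛-∷ q r ℓ w) ⟨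
  P * coeff (q ⊛ r) (ℓ ∷ w) + V
    ≡⟨ coeff-⊛-∷ p (q ⊛ r) ℓ w ⟨
  coeff (p ⊛ (q ⊛ r)) (ℓ ∷ w)
    ∎
  where
  open ≡-Reasoning
  P = coeff p []
  Q = coeff q []
  R = coeff r (ℓ ∷ w)
  U = coeff (∂ ℓ q ⊛ r) w
  V = coeff (∂ ℓ p ⊛ (q ⊛ r)) w

-- The derivation D_f

coeff-letter⊛-∷ : ∀ ℓ h w → coeff (mono [ ℓ ] ⊛ h) (ℓ ∷ w) ≡ coeff h w
coeff-letter⊛-∷ ℓ h w = begin
  coeff (mono [ ℓ ] ⊛ h) (ℓ ∷ w)                    ≡⟨ coeff-⊛-∷ˡ 1ℚ [ ℓ ] [] h (ℓ ∷ w) ⟩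
  coeff (termMul 1ℚ [ ℓ ] h) (ℓ ∷ w) + 0ℚ           ≡⟨ +-identityʳ _ ⟩
  coeff (termMul 1ℚ [ ℓ ] h) (ℓ ∷ w)                ≡⟨ coeff-termMul-∷ 1ℚ ℓ [] h w ⟩
  coeff (termMul 1ℚ [] h) w                         ≡⟨ coeff-termMul-[] 1ℚ h w ⟩
  1ℚ * coeff h w                                    ≡⟨ *-identityˡ _ ⟩
  coeff h w                                         ∎
  where open ≡-Reasoning

coeff-letter⊛-≢ : ∀ {ℓ ℓ′} h w → ℓ′ ≢ ℓ → coeff (mono [ ℓ′ ] ⊛ h) (ℓ ∷ w) ≡ 0ℚ
coeff-letter⊛-≢ {ℓ} {ℓ′} h w ℓ′≢ℓ =
  trans (coeff-⊛-∷ˡ 1ℚ [ ℓ′ ] [] h (ℓ ∷ w)) (trans (+-identityʳ _) (coeff-termMul-≢ 1ℚ [] h w ℓ′≢ℓ))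

coeff-letter⊛-[] : ∀ ℓ h → coeff (mono [ ℓ ] ⊛ h) [] ≡ 0ℚ
coeff-letter⊛-[] ℓ h = trans (coeff-⊛-[] (mono [ ℓ ]) h) (*-zeroˡ (coeff h []))

coeff-⊛-[]ʳ : ∀ p w → coeff (p ⊛ []) w ≡ 0ℚ
coeff-⊛-[]ʳ [] w = refl
coeff-⊛-[]ʳ ((c , v) ∷ p) w = trans (coeff-⊛-∷ˡ c v p [] w) (trans (+-identityˡ _) (coeff-⊛-[]ʳ p w))

coeff-⊛-∷ʳ : ∀ p c v q w → coeff (p ⊛ ((c , v) ∷ q)) w ≡ c * coeff (p ⊛ mono v) w + coeff (p ⊛ q) w
coeff-⊛-∷ʳ [] c v q w = sym (cong (_+ 0ℚ) (*-zeroʳ c))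
coeff-⊛-∷ʳ ((d , u) ∷ p) c v q w = begin
  coeff (((d , u) ∷ p) ⊛ ((c , v) ∷ q)) w
    ≡⟨ coeff-⊛-∷ˡ d u p ((c , v) ∷ q) w ⟩
  coeff ((d * c , u ++ v) ∷ termMul d u q) w + coeff (p ⊛ ((c , v) ∷ q)) w
    ≡⟨ cong₂ _+_ (coeff-∷ (d * c) (u ++ v) (termMul d u q) w) (coeff-⊛-∷ʳ p c v q w) ⟩
  (coeffTerm (d * c) (u ++ v) w + A) + (c * B + C)
    ≡⟨ cong (λ z → (z + A) + (c * B + C)) dc≡c·d1 ⟩
  (c * T + A) + (c * B + C)
    ≡⟨ solve 5 (λ c T A B C → (c :* T :+ A) :+ (c :* B :+ C) := c :* (T :+ B) :+ (A :+ C)) refl c T A B C ⟩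
  c * (T + B) + (A + C)
    ≡⟨ cong₂ (λ z z′ → c * (z + B) + z′) (trans (coeff-∷ (d * 1ℚ) (u ++ v) [] w) (+-identityʳ T)) (coeff-⊛-∷ˡ d u p q w) ⟨
  c * (coeff (termMul d u (mono v)) w + B) + coeff (((d , u) ∷ p) ⊛ q) w
    ≡⟨ cong (λ z → c * z + coeff (((d , u) ∷ p) ⊛ q) w) (coeff-⊛-∷ˡ d u p (mono v) w) ⟨
  c * coeff (((d , u) ∷ p) ⊛ mono v) w + coeff (((d , u) ∷ p) ⊛ q) w
    ∎
  where
  open ≡-Reasoning
  A = coeff (termMul d u q) w
  B = coeff (p ⊛ mono v) w
  C = coeff (p ⊛ q) w
  T = coeffTerm (d * 1ℚ) (u ++ v) w
  dc≡c·d1 : coeffTerm (d * c) (u ++ v) w ≡ c * T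
  dc≡c·d1 = trans (cong (λ z → coeffTerm z (u ++ v) w) (solve 2 (λ c d → d :* c := c :* (d :* con 1ℚ)) refl c d))
                  (coeffTerm-* c (d * 1ℚ) (u ++ v) w)

-1ℚ : ℚ
-1ℚ = - 1ℚ

yBracket : Poly → Poly
yBracket f = ⟦ mono [ Y ] , f ⟧

coeff-⟦⟧ : ∀ f g w → coeff ⟦ f , g ⟧ w ≡ coeff (f ⊛ g) w + -1ℚ * coeff (g ⊛ f) w
coeff-⟦⟧ f g w = trans (coeff-++ (f ⊛ g) (-1ℚ • (g ⊛ f)) w) (cong (coeff (f ⊛ g) w +_) (coeff-• -1ℚ (g ⊛ f) w))

coeff-yBracket-⊛ : ∀ f p w →
  coeff (yBracket f ⊛ p) w ≡ coeff (mono [ Y ] ⊛ (f ⊛ p)) w + -1ℚ * coeff (f ⊛ (mono [ Y ] ⊛ p)) w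
coeff-yBracket-⊛ f p w = begin
  coeff (yBracket f ⊛ p) w
    ≡⟨ coeff-++-⊛ (y ⊛ f) (-1ℚ • (f ⊛ y)) p w ⟩
  coeff ((y ⊛ f) ⊛ p) w + coeff ((-1ℚ • (f ⊛ y)) ⊛ p) w
    ≡⟨ cong₂ _+_ (⊛-assoc y f p w) (coeff-•-⊛ -1ℚ (f ⊛ y) p w) ⟩
  coeff (y ⊛ (f ⊛ p)) w + -1ℚ * coeff ((f ⊛ y) ⊛ p) w
    ≡⟨ cong (λ z → coeff (y ⊛ (f ⊛ p)) w + -1ℚ * z) (⊛-assoc f y p w) ⟩
  coeff (y ⊛ (f ⊛ p)) w + -1ℚ * coeff (f ⊛ (y ⊛ p)) w
    ∎
  where
  open ≡-Reasoning
  y = mono [ Y ]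

coeff-yBracket-[] : ∀ f → coeff (yBracket f) [] ≡ 0ℚ
coeff-yBracket-[] f = begin
  coeff (yBracket f) []                                             ≡⟨ coeff-⟦⟧ (mono [ Y ]) f [] ⟩
  coeff (mono [ Y ] ⊛ f) [] + -1ℚ * coeff (f ⊛ mono [ Y ]) []
    ≡⟨ cong₂ (λ a b → a + -1ℚ * b) (coeff-letter⊛-[] Y f) (coeff-⊛-[] f (mono [ Y ])) ⟩
  0ℚ + -1ℚ * (coeff f [] * 0ℚ)                                      ≡⟨ cong (λ z → 0ℚ + -1ℚ * z) (*-zeroʳ (coeff f [])) ⟩
  0ℚ                                                                ∎
  where open ≡-Reasoning

coeff-Der-term : ∀ f c v g w → coeff (Der f ((c , v) ∷ g)) w ≡ c * coeff (Dword f v) w + coeff (Der f g) w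
coeff-Der-term f c v g w =
  trans (coeff-++ (c • Dword f v) (Der f g) w) (cong (_+ coeff (Der f g) w) (coeff-• c (Dword f v) w))

coeff-Dword-Y : ∀ f v w → coeff (Dword f (Y ∷ v)) w ≡ coeff (yBracket f ⊛ mono v) w + coeff (mono [ Y ] ⊛ Dword f v) w
coeff-Dword-Y f v w = coeff-++ (yBracket f ⊛ mono v) (mono [ Y ] ⊛ Dword f v) w

coeff-Dword-[] : ∀ f v → coeff (Dword f v) [] ≡ 0ℚ
coeff-Dword-[] f [] = refl
coeff-Dword-[] f (X ∷ v) = coeff-letter⊛-[] X (Dword f v)
coeff-Dword-[] f (Y ∷ v) = begin
  coeff (Dword f (Y ∷ v)) []                                            ≡⟨ coeff-Dword-Y f v [] ⟩
  coeff (yBracket f ⊛ mono v) [] + coeff (mono [ Y ] ⊛ Dword f v) []    ≡⟨ cong₂ _+_ (coeff-⊛-[] (yBracket f) (mono v)) (coeff-letter⊛-[] Y (Dword f v)) ⟩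
  coeff (yBracket f) [] * coeff (mono v) [] + 0ℚ                        ≡⟨ cong (λ z → z * coeff (mono v) [] + 0ℚ) (coeff-yBracket-[] f) ⟩
  0ℚ * coeff (mono v) [] + 0ℚ                                           ≡⟨ cong (_+ 0ℚ) (*-zeroˡ (coeff (mono v) [])) ⟩
  0ℚ                                                                    ∎
  where open ≡-Reasoning

coeff-Der-[] : ∀ f g → coeff (Der f g) [] ≡ 0ℚ
coeff-Der-[] f [] = refl
coeff-Der-[] f ((c , v) ∷ g) = begin
  coeff (Der f ((c , v) ∷ g)) []                     ≡⟨ coeff-Der-term f c v g [] ⟩
  c * coeff (Dword f v) [] + coeff (Der f g) []      ≡⟨ cong₂ (λ a b → c * a + b) (coeff-Dword-[] f v) (coeff-Der-[] f g) ⟩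
  c * 0ℚ + 0ℚ                                        ≡⟨ cong (_+ 0ℚ) (*-zeroʳ c) ⟩
  0ℚ                                                 ∎
  where open ≡-Reasoning

-- D_f(ℓ v) = ℓ D_f(v) + [y , f] v if ℓ = y, and ℓ D_f(v) if ℓ = x.
coeff-Der-∷ : ∀ f g ℓ w → coeff (Der f g) (ℓ ∷ w) ≡ coeff (Der f (∂ ℓ g)) w + coeff (yBracket f ⊛ ∂ Y g) (ℓ ∷ w)
coeff-Der-∷ f [] ℓ w = sym (trans (+-identityˡ _) (coeff-⊛-[]ʳ (yBracket f) (ℓ ∷ w)))
coeff-Der-∷ f ((c , []) ∷ g) ℓ w = begin
  coeff (Der f ((c , []) ∷ g)) (ℓ ∷ w)      ≡⟨ coeff-Der-term f c [] g (ℓ ∷ w) ⟩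
  c * 0ℚ + coeff (Der f g) (ℓ ∷ w)          ≡⟨ cong (_+ coeff (Der f g) (ℓ ∷ w)) (*-zeroʳ c) ⟩
  0ℚ + coeff (Der f g) (ℓ ∷ w)              ≡⟨ +-identityˡ _ ⟩
  coeff (Der f g) (ℓ ∷ w)                   ≡⟨ coeff-Der-∷ f g ℓ w ⟩
  coeff (Der f (∂ ℓ g)) w + coeff (yBracket f ⊛ ∂ Y g) (ℓ ∷ w) ∎
  where open ≡-Reasoning
coeff-Der-∷ f ((c , X ∷ v) ∷ g) X w = begin
  coeff (Der f ((c , X ∷ v) ∷ g)) (X ∷ w)
    ≡⟨ coeff-Der-term f c (X ∷ v) g (X ∷ w) ⟩
  c * coeff (mono [ X ] ⊛ Dword f v) (X ∷ w) + coeff (Der f g) (X ∷ w)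
    ≡⟨ cong₂ _+_ (cong (c *_) (coeff-letter⊛-∷ X (Dword f v) w)) (coeff-Der-∷ f g X w) ⟩
  c * coeff (Dword f v) w + (coeff (Der f (∂ X g)) w + B)
    ≡⟨ ℚP.+-assoc (c * coeff (Dword f v) w) _ B ⟨
  (c * coeff (Dword f v) w + coeff (Der f (∂ X g)) w) + B
    ≡⟨ cong (_+ B) (coeff-Der-term f c v (∂ X g) w) ⟨
  coeff (Der f ((c , v) ∷ ∂ X g)) w + B
    ∎
  where
  open ≡-Reasoning
  B = coeff (yBracket f ⊛ ∂ Y g) (X ∷ w)
coeff-Der-∷ f ((c , X ∷ v) ∷ g) Y w = begin
  coeff (Der f ((c , X ∷ v) ∷ g)) (Y ∷ w)
    ≡⟨ coeff-Der-term f c (X ∷ v) g (Y ∷ w) ⟩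
  c * coeff (mono [ X ] ⊛ Dword f v) (Y ∷ w) + coeff (Der f g) (Y ∷ w)
    ≡⟨ cong (λ z → c * z + coeff (Der f g) (Y ∷ w)) (coeff-letter⊛-≢ (Dword f v) w (λ ())) ⟩
  c * 0ℚ + coeff (Der f g) (Y ∷ w)
    ≡⟨ cong (_+ coeff (Der f g) (Y ∷ w)) (*-zeroʳ c) ⟩
  0ℚ + coeff (Der f g) (Y ∷ w)
    ≡⟨ +-identityˡ _ ⟩
  coeff (Der f g) (Y ∷ w)
    ≡⟨ coeff-Der-∷ f g Y w ⟩
  coeff (Der f (∂ Y g)) w + coeff (yBracket f ⊛ ∂ Y g) (Y ∷ w)
    ∎
  where open ≡-Reasoning
coeff-Der-∷ f ((c , Y ∷ v) ∷ g) X w = begin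
  coeff (Der f ((c , Y ∷ v) ∷ g)) (X ∷ w)
    ≡⟨ coeff-Der-term f c (Y ∷ v) g (X ∷ w) ⟩
  c * coeff (Dword f (Y ∷ v)) (X ∷ w) + coeff (Der f g) (X ∷ w)
    ≡⟨ cong₂ _+_ (cong (c *_) (coeff-Dword-Y f v (X ∷ w))) (coeff-Der-∷ f g X w) ⟩
  c * (T + coeff (mono [ Y ] ⊛ Dword f v) (X ∷ w)) + (D + B)
    ≡⟨ cong (λ z → c * (T + z) + (D + B)) (coeff-letter⊛-≢ (Dword f v) w (λ ())) ⟩
  c * (T + 0ℚ) + (D + B)
    ≡⟨ solve 4 (λ c T D B → c :* (T :+ con 0ℚ) :+ (D :+ B) := D :+ (c :* T :+ B)) refl c T D B ⟩
  D + (c * T + B)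
    ≡⟨ cong (D +_) (coeff-⊛-∷ʳ (yBracket f) c v (∂ Y g) (X ∷ w)) ⟨
  D + coeff (yBracket f ⊛ ((c , v) ∷ ∂ Y g)) (X ∷ w)
    ∎
  where
  open ≡-Reasoning
  T = coeff (yBracket f ⊛ mono v) (X ∷ w)
  D = coeff (Der f (∂ X g)) w
  B = coeff (yBracket f ⊛ ∂ Y g) (X ∷ w)
coeff-Der-∷ f ((c , Y ∷ v) ∷ g) Y w = begin
  coeff (Der f ((c , Y ∷ v) ∷ g)) (Y ∷ w)
    ≡⟨ coeff-Der-term f c (Y ∷ v) g (Y ∷ w) ⟩
  c * coeff (Dword f (Y ∷ v)) (Y ∷ w) + coeff (Der f g) (Y ∷ w)
    ≡⟨ cong₂ _+_ (cong (c *_) (coeff-Dword-Y f v (Y ∷ w))) (coeff-Der-∷ f g Y w) ⟩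
  c * (T + coeff (mono [ Y ] ⊛ Dword f v) (Y ∷ w)) + (D + B)
    ≡⟨ cong (λ z → c * (T + z) + (D + B)) (coeff-letter⊛-∷ Y (Dword f v) w) ⟩
  c * (T + V) + (D + B)
    ≡⟨ solve 5 (λ c T V D B → c :* (T :+ V) :+ (D :+ B) := (c :* V :+ D) :+ (c :* T :+ B)) refl c T V D B ⟩
  (c * V + D) + (c * T + B)
    ≡⟨ cong₂ _+_ (coeff-Der-term f c v (∂ Y g) w) (coeff-⊛-∷ʳ (yBracket f) c v (∂ Y g) (Y ∷ w)) ⟨
  coeff (Der f ((c , v) ∷ ∂ Y g)) w + coeff (yBracket f ⊛ ((c , v) ∷ ∂ Y g)) (Y ∷ w)
    ∎
  where
  open ≡-Reasoning
  T = coeff (yBracket f ⊛ mono v) (Y ∷ w)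
  V = coeff (Dword f v) w
  D = coeff (Der f (∂ Y g)) w
  B = coeff (yBracket f ⊛ ∂ Y g) (Y ∷ w)

x≡0⇒x*y≡0 : ∀ {x} y → x ≡ 0ℚ → x * y ≡ 0ℚ
x≡0⇒x*y≡0 y refl = *-zeroˡ y

y≡0⇒x*y≡0 : ∀ x {y} → y ≡ 0ℚ → x * y ≡ 0ℚ
y≡0⇒x*y≡0 x refl = *-zeroʳ x

Depth≥ : ℕ → Poly → Set
Depth≥ n q = ∀ u → countY u < n → coeff q u ≡ 0ℚ

depth≥0 : ∀ q → Depth≥ 0 q
depth≥0 q u ()

depth-∂x : ∀ {n} q → Depth≥ n q → Depth≥ n (∂ X q)
depth-∂x q dq u lt = trans (coeff-∂ X q u) (dq (X ∷ u) lt)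

depth-∂y : ∀ {n} q → Depth≥ (suc n) q → Depth≥ n (∂ Y q)
depth-∂y q dq u lt = trans (coeff-∂ Y q u) (dq (Y ∷ u) (s≤s lt))

depth-⊛ : ∀ n m q p → Depth≥ n q → Depth≥ m p → Depth≥ (n ℕ.+ m) (q ⊛ p)
depth-⊛ n m q p dq dp [] lt = trans (coeff-⊛-[] q p) (cases n dq lt)
  where
  cases : ∀ n → Depth≥ n q → 0 < n ℕ.+ m → coeff q [] * coeff p [] ≡ 0ℚ
  cases zero    _  lt = y≡0⇒x*y≡0 (coeff q []) (dp [] lt)
  cases (suc n) dq _  = x≡0⇒x*y≡0 (coeff p []) (dq [] (s≤s z≤n))
depth-⊛ n m q p dq dp (ℓ ∷ u) lt = begin
  coeff (q ⊛ p) (ℓ ∷ u)                                  ≡⟨ coeff-⊛-∷ q p ℓ u ⟩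
  coeff q [] * coeff p (ℓ ∷ u) + coeff (∂ ℓ q ⊛ p) u     ≡⟨ cong₂ _+_ (head n ℓ dq lt) (tail n ℓ dq lt) ⟩
  0ℚ + 0ℚ                                                ∎
  where
  open ≡-Reasoning
  head : ∀ n ℓ → Depth≥ n q → countY (ℓ ∷ u) < n ℕ.+ m → coeff q [] * coeff p (ℓ ∷ u) ≡ 0ℚ
  head zero ℓ _ lt = y≡0⇒x*y≡0 (coeff q []) (dp (ℓ ∷ u) lt)
  head (suc n) ℓ dq _ = x≡0⇒x*y≡0 (coeff p (ℓ ∷ u)) (dq [] (s≤s z≤n))
  tail : ∀ n ℓ → Depth≥ n q → countY (ℓ ∷ u) < n ℕ.+ m → coeff (∂ ℓ q ⊛ p) u ≡ 0ℚ
  tail n X dq lt = depth-⊛ n m (∂ X q) p (depth-∂x q dq) dp u lt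
  tail zero Y _ lt = depth-⊛ 0 m (∂ Y q) p (depth≥0 (∂ Y q)) dp u (ℕP.<-trans (ℕP.n<1+n _) lt)
  tail (suc n) Y dq (s≤s lt) = depth-⊛ n m (∂ Y q) p (depth-∂y q dq) dp u lt

depth-y : Depth≥ 1 (mono [ Y ])
depth-y u lt = trans (coeff-mono [ Y ] u) (coeffTerm-≢ 1ℚ [ Y ] u (y≢u lt))
  where
  y≢u : countY u < 1 → [ Y ] ≢ u
  y≢u (s≤s ()) refl

depth-yBracket-⊛ : ∀ f p → Depth≥ 1 f → Depth≥ 2 (yBracket f ⊛ p)
depth-yBracket-⊛ f p df u lt = begin
  coeff (yBracket f ⊛ p) u                                                    ≡⟨ coeff-yBracket-⊛ f p u ⟩
  coeff (mono [ Y ] ⊛ (f ⊛ p)) u + -1ℚ * coeff (f ⊛ (mono [ Y ] ⊛ p)) u     ≡⟨ cong₂ (λ a b → a + -1ℚ * b) y·fp f·yp ⟩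
  0ℚ + -1ℚ * 0ℚ                                                               ∎
  where
  open ≡-Reasoning
  y·fp : coeff (mono [ Y ] ⊛ (f ⊛ p)) u ≡ 0ℚ
  y·fp = depth-⊛ 1 1 (mono [ Y ]) (f ⊛ p) depth-y (depth-⊛ 1 0 f p df (depth≥0 p)) u lt
  f·yp : coeff (f ⊛ (mono [ Y ] ⊛ p)) u ≡ 0ℚ
  f·yp = depth-⊛ 1 1 f (mono [ Y ] ⊛ p) df (depth-⊛ 1 0 (mono [ Y ]) p depth-y (depth≥0 p)) u lt

depth-Der : ∀ f h → Depth≥ 1 f → Depth≥ 2 (Der f h)
depth-Der f h df [] lt = coeff-Der-[] f h
depth-Der f h df (ℓ ∷ u) lt = begin
  coeff (Der f h) (ℓ ∷ u)                                          ≡⟨ coeff-Der-∷ f h ℓ u ⟩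
  coeff (Der f (∂ ℓ h)) u + coeff (yBracket f ⊛ ∂ Y h) (ℓ ∷ u)     ≡⟨ cong₂ _+_ (depth-Der f (∂ ℓ h) df u (ℕP.≤-<-trans (countY≤ ℓ) lt))
                                                                                (depth-yBracket-⊛ f (∂ Y h) df (ℓ ∷ u) lt) ⟩
  0ℚ + 0ℚ                                                          ∎
  where
  open ≡-Reasoning
  countY≤ : ∀ ℓ → countY u ≤ countY (ℓ ∷ u)
  countY≤ X = ℕP.≤-refl
  countY≤ Y = ℕP.n≤1+n _

off-support : ∀ (q : ℚ) {A : Set} → (q ≢ 0ℚ → A) → ¬ A → q ≡ 0ℚ
off-support q q≢0⇒A ¬A with q ℚP.≟ 0ℚ
... | yes q≡0 = q≡0
... | no q≢0  = ⊥-elim (¬A (q≢0⇒A q≢0))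

coeff-off-degree : ∀ {b} q → Homogeneous b q → ∀ u → length u ≢ b → coeff q u ≡ 0ℚ
coeff-off-degree q hq u = off-support (coeff q u) (hq u)

coeff-⊛-short : ∀ {b} q → Homogeneous b q → ∀ p u → length u < b → coeff (p ⊛ q) u ≡ 0ℚ
coeff-⊛-short q hq p [] lt = trans (coeff-⊛-[] p q) (y≡0⇒x*y≡0 (coeff p []) (coeff-off-degree q hq [] (ℕP.<⇒≢ lt)))
coeff-⊛-short q hq p (ℓ ∷ u) lt = begin
  coeff (p ⊛ q) (ℓ ∷ u)                               ≡⟨ coeff-⊛-∷ p q ℓ u ⟩
  coeff p [] * coeff q (ℓ ∷ u) + coeff (∂ ℓ p ⊛ q) u  ≡⟨ cong₂ _+_ (y≡0⇒x*y≡0 (coeff p []) (coeff-off-degree q hq (ℓ ∷ u) (ℕP.<⇒≢ lt)))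
                                                                  (coeff-⊛-short q hq (∂ ℓ p) u (ℕP.<-trans (ℕP.n<1+n _) lt)) ⟩
  0ℚ + 0ℚ                                             ∎
  where open ≡-Reasoning

coeff-⊛-split : ∀ {b} q → Homogeneous b q → ∀ u p v → length v ≡ b → coeff (p ⊛ q) (u ++ v) ≡ coeff p u * coeff q v
coeff-⊛-split q hq [] p [] _ = coeff-⊛-[] p q
coeff-⊛-split q hq [] p (ℓ ∷ v) refl = begin
  coeff (p ⊛ q) (ℓ ∷ v)                                ≡⟨ coeff-⊛-∷ p q ℓ v ⟩
  coeff p [] * coeff q (ℓ ∷ v) + coeff (∂ ℓ p ⊛ q) v   ≡⟨ cong (coeff p [] * coeff q (ℓ ∷ v) +_) (coeff-⊛-short q hq (∂ ℓ p) v (ℕP.n<1+n _)) ⟩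
  coeff p [] * coeff q (ℓ ∷ v) + 0ℚ                    ≡⟨ +-identityʳ _ ⟩
  coeff p [] * coeff q (ℓ ∷ v)                         ∎
  where open ≡-Reasoning
coeff-⊛-split q hq (ℓ ∷ u) p v refl = begin
  coeff (p ⊛ q) (ℓ ∷ u ++ v)                                        ≡⟨ coeff-⊛-∷ p q ℓ (u ++ v) ⟩
  coeff p [] * coeff q (ℓ ∷ u ++ v) + coeff (∂ ℓ p ⊛ q) (u ++ v)    ≡⟨ cong₂ _+_ (y≡0⇒x*y≡0 (coeff p []) (coeff-off-degree q hq (ℓ ∷ u ++ v) too-long))
                                                                                 (coeff-⊛-split q hq u (∂ ℓ p) v refl) ⟩
  0ℚ + coeff (∂ ℓ p) u * coeff q v                                  ≡⟨ +-identityˡ _ ⟩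
  coeff (∂ ℓ p) u * coeff q v                                       ≡⟨ cong (_* coeff q v) (coeff-∂ ℓ p u) ⟩
  coeff p (ℓ ∷ u) * coeff q v                                       ∎
  where
  open ≡-Reasoning
  too-long : length (ℓ ∷ u ++ v) ≢ length v
  too-long e = ℕP.<-irrefl (sym e) (s≤s (ℕP.≤-trans (ℕP.m≤n+m (length v) (length u)) (ℕP.≤-reflexive (sym (length-++ u)))))

x^_ : ℕ → Word
x^ n = replicate n X

countY-++ : ∀ u v → countY (u ++ v) ≡ countY u ℕ.+ countY v
countY-++ [] v = refl
countY-++ (X ∷ u) v = countY-++ u v
countY-++ (Y ∷ u) v = cong suc (countY-++ u v)

countY-x^ : ∀ n → countY (x^ n) ≡ 0
countY-x^ zero = refl
countY-x^ (suc n) = countY-x^ n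

∂x^ : ℕ → Poly → Poly
∂x^ zero h = h
∂x^ (suc t) h = ∂x^ t (∂ X h)

coeff-∂x^ : ∀ t h z → coeff (∂x^ t h) z ≡ coeff h (x^ t ++ z)
coeff-∂x^ zero h z = refl
coeff-∂x^ (suc t) h z = trans (coeff-∂x^ t (∂ X h) z) (coeff-∂ X h (x^ t ++ z))

NoLeadingX : Poly → Set
NoLeadingX q = ∀ z → coeff q (X ∷ z) ≡ 0ℚ

coeff-⊛-x^y : ∀ q → NoLeadingX q → ∀ K r →
  coeff (r ⊛ q) (x^ K ++ [ Y ]) ≡ coeff r (x^ K) * coeff q [ Y ] + coeff r (x^ K ++ [ Y ]) * coeff q []
coeff-⊛-x^y q nq zero r = begin
  coeff (r ⊛ q) [ Y ]                                  ≡⟨ coeff-⊛-∷ r q Y [] ⟩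
  coeff r [] * coeff q [ Y ] + coeff (∂ Y r ⊛ q) []    ≡⟨ cong (coeff r [] * coeff q [ Y ] +_) (coeff-⊛-[] (∂ Y r) q) ⟩
  coeff r [] * coeff q [ Y ] + coeff (∂ Y r) [] * coeff q []
    ≡⟨ cong (λ z → coeff r [] * coeff q [ Y ] + z * coeff q []) (coeff-∂ Y r []) ⟩
  coeff r [] * coeff q [ Y ] + coeff r [ Y ] * coeff q [] ∎
  where open ≡-Reasoning
coeff-⊛-x^y q nq (suc K) r = begin
  coeff (r ⊛ q) (X ∷ x^ K ++ [ Y ])
    ≡⟨ coeff-⊛-∷ r q X (x^ K ++ [ Y ]) ⟩
  coeff r [] * coeff q (X ∷ x^ K ++ [ Y ]) + coeff (∂ X r ⊛ q) (x^ K ++ [ Y ])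
    ≡⟨ cong₂ _+_ (y≡0⇒x*y≡0 (coeff r []) (nq _)) (coeff-⊛-x^y q nq K (∂ X r)) ⟩
  0ℚ + (coeff (∂ X r) (x^ K) * coeff q [ Y ] + coeff (∂ X r) (x^ K ++ [ Y ]) * coeff q [])
    ≡⟨ +-identityˡ _ ⟩
  coeff (∂ X r) (x^ K) * coeff q [ Y ] + coeff (∂ X r) (x^ K ++ [ Y ]) * coeff q []
    ≡⟨ cong₂ (λ a b → a * coeff q [ Y ] + b * coeff q []) (coeff-∂ X r (x^ K)) (coeff-∂ X r (x^ K ++ [ Y ])) ⟩
  coeff r (x^ suc K) * coeff q [ Y ] + coeff r (x^ suc K ++ [ Y ]) * coeff q []
    ∎
  where open ≡-Reasoning

coeff-⊛-x^yx^y : ∀ q → NoLeadingX q → coeff q [] ≡ 0ℚ → ∀ K n f → Depth≥ 1 f →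
  coeff (f ⊛ q) (x^ n ++ Y ∷ x^ K ++ [ Y ]) ≡ coeff f (x^ n ++ Y ∷ x^ K) * coeff q [ Y ]
coeff-⊛-x^yx^y q nq q₀ K zero f df = begin
  coeff (f ⊛ q) (Y ∷ x^ K ++ [ Y ])
    ≡⟨ coeff-⊛-∷ f q Y (x^ K ++ [ Y ]) ⟩
  coeff f [] * coeff q (Y ∷ x^ K ++ [ Y ]) + coeff (∂ Y f ⊛ q) (x^ K ++ [ Y ])
    ≡⟨ cong₂ _+_ (x≡0⇒x*y≡0 _ (df [] (s≤s z≤n))) (coeff-⊛-x^y q nq K (∂ Y f)) ⟩
  0ℚ + (coeff (∂ Y f) (x^ K) * coeff q [ Y ] + coeff (∂ Y f) (x^ K ++ [ Y ]) * coeff q [])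
    ≡⟨ cong₂ (λ a b → 0ℚ + (a * coeff q [ Y ] + b)) (coeff-∂ Y f (x^ K)) (y≡0⇒x*y≡0 (coeff (∂ Y f) (x^ K ++ [ Y ])) q₀) ⟩
  0ℚ + (coeff f (Y ∷ x^ K) * coeff q [ Y ] + 0ℚ)
    ≡⟨ trans (+-identityˡ _) (+-identityʳ _) ⟩
  coeff f (Y ∷ x^ K) * coeff q [ Y ]
    ∎
  where open ≡-Reasoning
coeff-⊛-x^yx^y q nq q₀ K (suc n) f df = begin
  coeff (f ⊛ q) (X ∷ W)                            ≡⟨ coeff-⊛-∷ f q X W ⟩
  coeff f [] * coeff q (X ∷ W) + coeff (∂ X f ⊛ q) W
    ≡⟨ cong₂ _+_ (x≡0⇒x*y≡0 _ (df [] (s≤s z≤n))) (coeff-⊛-x^yx^y q nq q₀ K n (∂ X f) (depth-∂x f df)) ⟩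
  0ℚ + coeff (∂ X f) (x^ n ++ Y ∷ x^ K) * coeff q [ Y ]
    ≡⟨ +-identityˡ _ ⟩
  coeff (∂ X f) (x^ n ++ Y ∷ x^ K) * coeff q [ Y ]
    ≡⟨ cong (_* coeff q [ Y ]) (coeff-∂ X f (x^ n ++ Y ∷ x^ K)) ⟩
  coeff f (x^ suc n ++ Y ∷ x^ K) * coeff q [ Y ]   ∎
  where
  open ≡-Reasoning
  W = x^ n ++ Y ∷ x^ K ++ [ Y ]

coeff-depth1⊛-x^y : ∀ p K f → Depth≥ 1 f → coeff (f ⊛ p) (x^ K ++ [ Y ]) ≡ coeff f (x^ K ++ [ Y ]) * coeff p []
coeff-depth1⊛-x^y p zero f df = begin
  coeff (f ⊛ p) [ Y ]                                 ≡⟨ coeff-⊛-∷ f p Y [] ⟩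
  coeff f [] * coeff p [ Y ] + coeff (∂ Y f ⊛ p) []   ≡⟨ cong₂ _+_ (x≡0⇒x*y≡0 _ (df [] (s≤s z≤n))) (coeff-⊛-[] (∂ Y f) p) ⟩
  0ℚ + coeff (∂ Y f) [] * coeff p []                  ≡⟨ +-identityˡ _ ⟩
  coeff (∂ Y f) [] * coeff p []                       ≡⟨ cong (_* coeff p []) (coeff-∂ Y f []) ⟩
  coeff f [ Y ] * coeff p []                          ∎
  where open ≡-Reasoning
coeff-depth1⊛-x^y p (suc K) f df = begin
  coeff (f ⊛ p) (X ∷ x^ K ++ [ Y ])
    ≡⟨ coeff-⊛-∷ f p X (x^ K ++ [ Y ]) ⟩
  coeff f [] * coeff p (X ∷ x^ K ++ [ Y ]) + coeff (∂ X f ⊛ p) (x^ K ++ [ Y ])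
    ≡⟨ cong₂ _+_ (x≡0⇒x*y≡0 _ (df [] (s≤s z≤n))) (coeff-depth1⊛-x^y p K (∂ X f) (depth-∂x f df)) ⟩
  0ℚ + coeff (∂ X f) (x^ K ++ [ Y ]) * coeff p []
    ≡⟨ +-identityˡ _ ⟩
  coeff (∂ X f) (x^ K ++ [ Y ]) * coeff p []
    ≡⟨ cong (_* coeff p []) (coeff-∂ X f (x^ K ++ [ Y ])) ⟩
  coeff f (x^ suc K ++ [ Y ]) * coeff p []
    ∎
  where open ≡-Reasoning

module DerivationCoeff (f : Poly) (df : Depth≥ 1 f) (K : ℕ) where

  derCoeff : Poly → ℕ → ℚ
  derCoeff h t = coeff (Der f h) (x^ t ++ Y ∷ x^ K ++ [ Y ])

  private
    y·∂yh-noLeadingX : ∀ h → NoLeadingX (mono [ Y ] ⊛ ∂ Y h)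
    y·∂yh-noLeadingX h z = coeff-letter⊛-≢ (∂ Y h) z (λ ())

    coeff-y·∂yh-y : ∀ h → coeff (mono [ Y ] ⊛ ∂ Y h) [ Y ] ≡ coeff h [ Y ]
    coeff-y·∂yh-y h = trans (coeff-letter⊛-∷ Y (∂ Y h) []) (coeff-∂ Y h [])

  derCoeff-suc : ∀ h t → derCoeff h (suc t) ≡ derCoeff (∂ X h) t + -1ℚ * (coeff f (x^ suc t ++ Y ∷ x^ K) * coeff h [ Y ])
  derCoeff-suc h t = begin
    derCoeff h (suc t)
      ≡⟨ coeff-Der-∷ f h X W ⟩
    derCoeff (∂ X h) t + coeff (yBracket f ⊛ p) (X ∷ W)
      ≡⟨ cong (derCoeff (∂ X h) t +_) (coeff-yBracket-⊛ f p (X ∷ W)) ⟩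
    derCoeff (∂ X h) t + (coeff (mono [ Y ] ⊛ (f ⊛ p)) (X ∷ W) + -1ℚ * coeff (f ⊛ q) (X ∷ W))
      ≡⟨ cong (λ z → derCoeff (∂ X h) t + (z + -1ℚ * coeff (f ⊛ q) (X ∷ W))) (coeff-letter⊛-≢ (f ⊛ p) W (λ ())) ⟩
    derCoeff (∂ X h) t + (0ℚ + -1ℚ * coeff (f ⊛ q) (X ∷ W))
      ≡⟨ cong (λ z → derCoeff (∂ X h) t + (0ℚ + -1ℚ * z)) (coeff-⊛-x^yx^y q (y·∂yh-noLeadingX h) (coeff-letter⊛-[] Y p) K (suc t) f df) ⟩
    derCoeff (∂ X h) t + (0ℚ + -1ℚ * (coeff f (x^ suc t ++ Y ∷ x^ K) * coeff q [ Y ]))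
      ≡⟨ cong (λ z → derCoeff (∂ X h) t + z) (+-identityˡ _) ⟩
    derCoeff (∂ X h) t + -1ℚ * (coeff f (x^ suc t ++ Y ∷ x^ K) * coeff q [ Y ])
      ≡⟨ cong (λ z → derCoeff (∂ X h) t + -1ℚ * (coeff f (x^ suc t ++ Y ∷ x^ K) * z)) (coeff-y·∂yh-y h) ⟩
    derCoeff (∂ X h) t + -1ℚ * (coeff f (x^ suc t ++ Y ∷ x^ K) * coeff h [ Y ])
      ∎
    where
    open ≡-Reasoning
    W = x^ t ++ Y ∷ x^ K ++ [ Y ]
    p = ∂ Y h
    q = mono [ Y ] ⊛ p

  derCoeff-zero : ∀ h → derCoeff h 0 ≡ coeff f (x^ K ++ [ Y ]) * coeff h [ Y ] + -1ℚ * (coeff f (Y ∷ x^ K) * coeff h [ Y ])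
  derCoeff-zero h = begin
    derCoeff h 0
      ≡⟨ coeff-Der-∷ f h Y W ⟩
    coeff (Der f p) W + coeff (yBracket f ⊛ p) (Y ∷ W)
      ≡⟨ cong₂ _+_ (depth-Der f p df W fewY) (coeff-yBracket-⊛ f p (Y ∷ W)) ⟩
    0ℚ + (coeff (mono [ Y ] ⊛ (f ⊛ p)) (Y ∷ W) + -1ℚ * coeff (f ⊛ q) (Y ∷ W))
      ≡⟨ +-identityˡ _ ⟩
    coeff (mono [ Y ] ⊛ (f ⊛ p)) (Y ∷ W) + -1ℚ * coeff (f ⊛ q) (Y ∷ W)
      ≡⟨ cong₂ (λ a b → a + -1ℚ * b) (trans (coeff-letter⊛-∷ Y (f ⊛ p) W) (coeff-depth1⊛-x^y p K f df))
                                     (coeff-⊛-x^yx^y q (y·∂yh-noLeadingX h) (coeff-letter⊛-[] Y p) K 0 f df) ⟩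
    coeff f W * coeff p [] + -1ℚ * (coeff f (Y ∷ x^ K) * coeff q [ Y ])
      ≡⟨ cong₂ (λ a b → coeff f W * a + -1ℚ * (coeff f (Y ∷ x^ K) * b)) (coeff-∂ Y h []) (coeff-y·∂yh-y h) ⟩
    coeff f W * coeff h [ Y ] + -1ℚ * (coeff f (Y ∷ x^ K) * coeff h [ Y ])
      ∎
    where
    open ≡-Reasoning
    W = x^ K ++ [ Y ]
    p = ∂ Y h
    q = mono [ Y ] ⊛ p
    fewY : countY W < 2
    fewY = subst (_< 2) (sym (trans (countY-++ (x^ K) [ Y ]) (cong (ℕ._+ 1) (countY-x^ K)))) (s≤s (s≤s z≤n))

  derCoeff-skip : ∀ t h → (∀ s → s < t → coeff h (x^ s ++ [ Y ]) ≡ 0ℚ) → derCoeff h t ≡ derCoeff (∂x^ t h) 0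
  derCoeff-skip zero h _ = refl
  derCoeff-skip (suc t) h vanish = begin
    derCoeff h (suc t)
      ≡⟨ derCoeff-suc h t ⟩
    derCoeff (∂ X h) t + -1ℚ * (coeff f (x^ suc t ++ Y ∷ x^ K) * coeff h [ Y ])
      ≡⟨ cong (derCoeff (∂ X h) t +_) (y≡0⇒x*y≡0 -1ℚ (y≡0⇒x*y≡0 (coeff f (x^ suc t ++ Y ∷ x^ K)) (vanish 0 (s≤s z≤n)))) ⟩
    derCoeff (∂ X h) t + 0ℚ
      ≡⟨ +-identityʳ _ ⟩
    derCoeff (∂ X h) t
      ≡⟨ derCoeff-skip t (∂ X h) (λ s lt → trans (coeff-∂ X h (x^ s ++ [ Y ])) (vanish (suc s) (s≤s lt))) ⟩
    derCoeff (∂x^ t (∂ X h)) 0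
      ∎
    where open ≡-Reasoning

  derCoeff-skip-past : ∀ d β h → (∀ s → s ≢ β → s < β ℕ.+ suc d → coeff h (x^ s ++ [ Y ]) ≡ 0ℚ) →
    derCoeff h (β ℕ.+ suc d) ≡ derCoeff (∂x^ (β ℕ.+ suc d) h) 0 + -1ℚ * (coeff f (x^ suc d ++ Y ∷ x^ K) * coeff h (x^ β ++ [ Y ]))
  derCoeff-skip-past d zero h vanish = begin
    derCoeff h (suc d)
      ≡⟨ derCoeff-suc h d ⟩
    derCoeff (∂ X h) d + -1ℚ * (coeff f (x^ suc d ++ Y ∷ x^ K) * coeff h [ Y ])
      ≡⟨ cong (_+ -1ℚ * (coeff f (x^ suc d ++ Y ∷ x^ K) * coeff h [ Y ]))
              (derCoeff-skip d (∂ X h) (λ s lt → trans (coeff-∂ X h (x^ s ++ [ Y ])) (vanish (suc s) (λ ()) (s≤s lt)))) ⟩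
    derCoeff (∂x^ d (∂ X h)) 0 + -1ℚ * (coeff f (x^ suc d ++ Y ∷ x^ K) * coeff h [ Y ])
      ∎
    where open ≡-Reasoning
  derCoeff-skip-past d (suc β) h vanish = begin
    derCoeff h (suc t)
      ≡⟨ derCoeff-suc h t ⟩
    derCoeff (∂ X h) t + -1ℚ * (coeff f (x^ suc t ++ Y ∷ x^ K) * coeff h [ Y ])
      ≡⟨ cong (derCoeff (∂ X h) t +_) (y≡0⇒x*y≡0 -1ℚ (y≡0⇒x*y≡0 (coeff f (x^ suc t ++ Y ∷ x^ K)) (vanish 0 (λ ()) (s≤s z≤n)))) ⟩
    derCoeff (∂ X h) t + 0ℚ
      ≡⟨ +-identityʳ _ ⟩
    derCoeff (∂ X h) t
      ≡⟨ derCoeff-skip-past d β (∂ X h) vanish′ ⟩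
    derCoeff (∂x^ t (∂ X h)) 0 + -1ℚ * (coeff f (x^ suc d ++ Y ∷ x^ K) * coeff (∂ X h) (x^ β ++ [ Y ]))
      ≡⟨ cong (λ z → derCoeff (∂x^ t (∂ X h)) 0 + -1ℚ * (coeff f (x^ suc d ++ Y ∷ x^ K) * z)) (coeff-∂ X h (x^ β ++ [ Y ])) ⟩
    derCoeff (∂x^ t (∂ X h)) 0 + -1ℚ * (coeff f (x^ suc d ++ Y ∷ x^ K) * coeff h (x^ suc β ++ [ Y ]))
      ∎
    where
    open ≡-Reasoning
    t = β ℕ.+ suc d
    vanish′ : ∀ s → s ≢ β → s < t → coeff (∂ X h) (x^ s ++ [ Y ]) ≡ 0ℚ
    vanish′ s s≢β lt = trans (coeff-∂ X h (x^ s ++ [ Y ])) (vanish (suc s) (λ e → s≢β (ℕP.suc-injective e)) (s≤s lt))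

-- Coefficients of Lie elements in depth one

coprime-1 : ∀ n → Coprime n 1
coprime-1 n = Coprime.sym (Coprime.1-coprimeTo n)

ℕtoℚ≡mkℚ : ∀ n → ℕtoℚ n ≡ ℚ.mkℚ (ℤ.+ n) 0 (coprime-1 n)
ℕtoℚ≡mkℚ n = ℚP.normalize-coprime (coprime-1 n)

ℕtoℚ-+ : ∀ m n → ℕtoℚ (m ℕ.+ n) ≡ ℕtoℚ m + ℕtoℚ n
ℕtoℚ-+ m n = sym (trans (cong₂ _+_ (ℕtoℚ≡mkℚ m) (ℕtoℚ≡mkℚ n)) (cong (ℚ._/ 1) numerator))
  where
  numerator : (Sign.+ ℤ.◃ m ℕ.* 1) ℤ.+ (ℤ.+ n ℤ.* ℤ.+ 1) ≡ ℤ.+ (m ℕ.+ n)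
  numerator = cong₂ ℤ._+_ (trans (ℤP.+◃n≡+n (m ℕ.* 1)) (cong ℤ.+_ (ℕP.*-identityʳ m))) (ℤP.*-identityʳ (ℤ.+ n))

ℕtoℚ-* : ∀ m n → ℕtoℚ (m ℕ.* n) ≡ ℕtoℚ m * ℕtoℚ n
ℕtoℚ-* m n = sym (trans (cong₂ _*_ (ℕtoℚ≡mkℚ m) (ℕtoℚ≡mkℚ n)) (cong (ℚ._/ 1) (sym (ℤP.pos-* m n))))

sign : ℕ → ℚ
sign zero = 1ℚ
sign (suc n) = -1ℚ * sign n

-- Opaque: unfolding _C_ during unification is very slow and blocks constraint solving.
opaque
  binomial : ℕ → ℕ → ℚ
  binomial n k = ℕtoℚ (n C k)

  binomial-def : ∀ n k → binomial n k ≡ ℕtoℚ (n C k)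
  binomial-def n k = refl

binomial-n-0 : ∀ n → binomial n 0 ≡ 1ℚ
binomial-n-0 n = binomial-def n 0

binomial-n-n : ∀ n → binomial n n ≡ 1ℚ
binomial-n-n n = trans (binomial-def n n) (cong ℕtoℚ (nCn≡1 n))

binomial-pascal : ∀ n k → binomial (suc n) (suc k) ≡ binomial n k + binomial n (suc k)
binomial-pascal n k = begin
  binomial (suc n) (suc k)            ≡⟨ binomial-def (suc n) (suc k) ⟩
  ℕtoℚ (suc n C suc k)                ≡⟨ cong ℕtoℚ (nCk+nC[k+1]≡[n+1]C[k+1] n k) ⟨
  ℕtoℚ (n C k ℕ.+ n C suc k)          ≡⟨ ℕtoℚ-+ (n C k) (n C suc k) ⟩
  ℕtoℚ (n C k) + ℕtoℚ (n C suc k)     ≡⟨ cong₂ _+_ (binomial-def n k) (binomial-def n (suc k)) ⟨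
  binomial n k + binomial n (suc k)   ∎
  where open ≡-Reasoning

xyx : Poly → ℕ → ℕ → ℚ
xyx p a b = coeff p (x^ a ++ Y ∷ x^ b)

coeffX : Poly → ℚ
coeffX p = coeff p [ X ]

-- The last field holds because the depth-one part of a Lie element is a combination of the
-- ad(x)^n(y); the first two are needed to make it stable under brackets.
record LieCoeffs (p : Poly) : Set where
  constructor lieCoeffs
  field
    coeff-ε≡0   : coeff p [] ≡ 0ℚ
    coeff-xx≡0  : ∀ s → coeff p (x^ suc (suc s)) ≡ 0ℚ
    xyx-law     : ∀ a b → xyx p a b ≡ sign b * binomial (a ℕ.+ b) b * xyx p (a ℕ.+ b) 0

module ProductWith (g : Poly) (g₀ : coeff g [] ≡ 0ℚ) (gxx : ∀ s → coeff g (x^ suc (suc s)) ≡ 0ℚ) where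

  coeff-⊛-x^suc : ∀ b r → coeff (r ⊛ g) (x^ suc b) ≡ coeff r (x^ b) * coeffX g
  coeff-⊛-x^suc zero r = begin
    coeff (r ⊛ g) [ X ]                                ≡⟨ coeff-⊛-∷ r g X [] ⟩
    coeff r [] * coeffX g + coeff (∂ X r ⊛ g) []       ≡⟨ cong (coeff r [] * coeffX g +_) (coeff-⊛-[] (∂ X r) g) ⟩
    coeff r [] * coeffX g + coeff (∂ X r) [] * coeff g [] ≡⟨ cong (coeff r [] * coeffX g +_) (y≡0⇒x*y≡0 (coeff (∂ X r) []) g₀) ⟩
    coeff r [] * coeffX g + 0ℚ                         ≡⟨ +-identityʳ _ ⟩
    coeff r [] * coeffX g                              ∎
    where open ≡-Reasoning
  coeff-⊛-x^suc (suc b) r = begin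
    coeff (r ⊛ g) (X ∷ x^ suc b)                                    ≡⟨ coeff-⊛-∷ r g X (x^ suc b) ⟩
    coeff r [] * coeff g (x^ suc (suc b)) + coeff (∂ X r ⊛ g) (x^ suc b) ≡⟨ cong₂ _+_ (y≡0⇒x*y≡0 (coeff r []) (gxx b)) (coeff-⊛-x^suc b (∂ X r)) ⟩
    0ℚ + coeff (∂ X r) (x^ b) * coeffX g                             ≡⟨ +-identityˡ _ ⟩
    coeff (∂ X r) (x^ b) * coeffX g                                  ≡⟨ cong (_* coeffX g) (coeff-∂ X r (x^ b)) ⟩
    coeff r (x^ suc b) * coeffX g                                    ∎
    where open ≡-Reasoning

  -- the contribution of factorisations v · x with v = x^a y x^(b-1)
  rightX : Poly → ℕ → ℕ → ℚ
  rightX r a zero = 0ℚ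
  rightX r a (suc b) = xyx r a b * coeffX g

  -- the contribution of factorisations x · v with v = x^(a-1) y x^b
  leftX : Poly → ℕ → ℕ → ℚ
  leftX f zero b = 0ℚ
  leftX f (suc a) b = coeffX f * xyx g a b

  coeff-⊛-yx^ : ∀ b r → coeff (r ⊛ g) (Y ∷ x^ b) ≡ coeff r [] * xyx g 0 b + rightX r 0 b
  coeff-⊛-yx^ zero r = begin
    coeff (r ⊛ g) [ Y ]                                  ≡⟨ coeff-⊛-∷ r g Y [] ⟩
    coeff r [] * xyx g 0 0 + coeff (∂ Y r ⊛ g) []        ≡⟨ cong (coeff r [] * xyx g 0 0 +_) (coeff-⊛-[] (∂ Y r) g) ⟩
    coeff r [] * xyx g 0 0 + coeff (∂ Y r) [] * coeff g [] ≡⟨ cong (coeff r [] * xyx g 0 0 +_) (y≡0⇒x*y≡0 (coeff (∂ Y r) []) g₀) ⟩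
    coeff r [] * xyx g 0 0 + 0ℚ                          ∎
    where open ≡-Reasoning
  coeff-⊛-yx^ (suc b) r = begin
    coeff (r ⊛ g) (Y ∷ x^ suc b)                               ≡⟨ coeff-⊛-∷ r g Y (x^ suc b) ⟩
    coeff r [] * xyx g 0 (suc b) + coeff (∂ Y r ⊛ g) (x^ suc b) ≡⟨ cong (coeff r [] * xyx g 0 (suc b) +_) (coeff-⊛-x^suc b (∂ Y r)) ⟩
    coeff r [] * xyx g 0 (suc b) + coeff (∂ Y r) (x^ b) * coeffX g ≡⟨ cong (λ z → coeff r [] * xyx g 0 (suc b) + z * coeffX g) (coeff-∂ Y r (x^ b)) ⟩
    coeff r [] * xyx g 0 (suc b) + rightX r 0 (suc b)           ∎
    where open ≡-Reasoning

  rightX-∂x : ∀ r a b → rightX (∂ X r) a b ≡ rightX r (suc a) b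
  rightX-∂x r a zero = refl
  rightX-∂x r a (suc b) = cong (_* coeffX g) (coeff-∂ X r (x^ a ++ Y ∷ x^ b))

  coeff-⊛-x^yx^-noX : ∀ b a r → (∀ s → coeff r (x^ suc s) ≡ 0ℚ) →
    coeff (r ⊛ g) (x^ a ++ Y ∷ x^ b) ≡ coeff r [] * xyx g a b + rightX r a b
  coeff-⊛-x^yx^-noX b zero r _ = coeff-⊛-yx^ b r
  coeff-⊛-x^yx^-noX b (suc a) r rx = begin
    coeff (r ⊛ g) (X ∷ x^ a ++ Y ∷ x^ b)
      ≡⟨ coeff-⊛-∷ r g X (x^ a ++ Y ∷ x^ b) ⟩
    R + coeff (∂ X r ⊛ g) (x^ a ++ Y ∷ x^ b)
      ≡⟨ cong (R +_) (coeff-⊛-x^yx^-noX b a (∂ X r) (λ s → trans (coeff-∂ X r (x^ suc s)) (rx (suc s)))) ⟩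
    R + (coeff (∂ X r) [] * xyx g a b + rightX (∂ X r) a b)
      ≡⟨ cong₂ (λ z z′ → R + (z + z′)) (x≡0⇒x*y≡0 (xyx g a b) (trans (coeff-∂ X r []) (rx 0))) (rightX-∂x r a b) ⟩
    R + (0ℚ + rightX r (suc a) b)
      ≡⟨ cong (R +_) (+-identityˡ _) ⟩
    R + rightX r (suc a) b
      ∎
    where
    open ≡-Reasoning
    R = coeff r [] * xyx g (suc a) b

  coeff-⊛-x^yx^ : ∀ f → coeff f [] ≡ 0ℚ → (∀ s → coeff f (x^ suc (suc s)) ≡ 0ℚ) →
    ∀ a b → xyx (f ⊛ g) a b ≡ leftX f a b + rightX f a b
  coeff-⊛-x^yx^ f f₀ fxx zero b = trans (coeff-⊛-yx^ b f) (cong (_+ rightX f 0 b) (x≡0⇒x*y≡0 (xyx g 0 b) f₀))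
  coeff-⊛-x^yx^ f f₀ fxx (suc a) b = begin
    coeff (f ⊛ g) (X ∷ x^ a ++ Y ∷ x^ b)
      ≡⟨ coeff-⊛-∷ f g X (x^ a ++ Y ∷ x^ b) ⟩
    coeff f [] * xyx g (suc a) b + coeff (∂ X f ⊛ g) (x^ a ++ Y ∷ x^ b)
      ≡⟨ cong₂ _+_ (x≡0⇒x*y≡0 (xyx g (suc a) b) f₀) (coeff-⊛-x^yx^-noX b a (∂ X f) (λ s → trans (coeff-∂ X f (x^ suc s)) (fxx s))) ⟩
    0ℚ + (coeff (∂ X f) [] * xyx g a b + rightX (∂ X f) a b)
      ≡⟨ +-identityˡ _ ⟩
    coeff (∂ X f) [] * xyx g a b + rightX (∂ X f) a b
      ≡⟨ cong₂ (λ z z′ → z * xyx g a b + z′) (coeff-∂ X f []) (rightX-∂x f a b) ⟩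
    leftX f (suc a) b + rightX f (suc a) b
      ∎
    where open ≡-Reasoning

xyx-law-0 : ∀ p a → xyx p a 0 ≡ sign 0 * binomial (a ℕ.+ 0) 0 * xyx p (a ℕ.+ 0) 0
xyx-law-0 p a rewrite ℕP.+-identityʳ a = begin
  xyx p a 0                            ≡⟨ *-identityˡ _ ⟨
  1ℚ * xyx p a 0                       ≡⟨ cong (_* xyx p a 0) (*-identityˡ 1ℚ) ⟨
  1ℚ * 1ℚ * xyx p a 0                  ≡⟨ cong (λ z → 1ℚ * z * xyx p a 0) (binomial-n-0 a) ⟨
  sign 0 * binomial a 0 * xyx p a 0    ∎
  where open ≡-Reasoning

private
  bracket-law-edge : ∀ cf cg s F G →
    (0ℚ + s * 1ℚ * F * cg) + -1ℚ * (0ℚ + s * 1ℚ * G * cf) ≡ (-1ℚ * s) * 1ℚ * ((cf * G + 0ℚ) + -1ℚ * (cg * F + 0ℚ))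
  bracket-law-edge = solve 5 (λ cf cg s F G →
    (con 0ℚ :+ s :* con 1ℚ :* F :* cg) :+ con -1ℚ :* (con 0ℚ :+ s :* con 1ℚ :* G :* cf)
      := (con -1ℚ :* s) :* con 1ℚ :* ((cf :* G :+ con 0ℚ) :+ con -1ℚ :* (cg :* F :+ con 0ℚ))) refl

  bracket-law-inner : ∀ cf cg s C₁ C₂ F G →
    (cf * ((-1ℚ * s) * C₂ * G) + (s * C₁ * F) * cg) + -1ℚ * (cg * ((-1ℚ * s) * C₂ * F) + (s * C₁ * G) * cf)
      ≡ (-1ℚ * s) * (C₁ + C₂) * ((cf * G + 0ℚ) + -1ℚ * (cg * F + 0ℚ))
  bracket-law-inner = solve 7 (λ cf cg s C₁ C₂ F G →
    (cf :* ((con -1ℚ :* s) :* C₂ :* G) :+ (s :* C₁ :* F) :* cg) :+ con -1ℚ :* (cg :* ((con -1ℚ :* s) :* C₂ :* F) :+ (s :* C₁ :* G) :* cf)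
      := (con -1ℚ :* s) :* (C₁ :+ C₂) :* ((cf :* G :+ con 0ℚ) :+ con -1ℚ :* (cg :* F :+ con 0ℚ))) refl

lieCoeffs-⟦⟧ : ∀ f g → LieCoeffs f → LieCoeffs g → LieCoeffs ⟦ f , g ⟧
lieCoeffs-⟦⟧ f g (lieCoeffs f₀ fxx fl) (lieCoeffs g₀ gxx gl) = lieCoeffs bracket-ε bracket-xx bracket-law
  where
  module FG = ProductWith g g₀ gxx
  module GF = ProductWith f f₀ fxx
  cf = coeffX f
  cg = coeffX g

  bracket-ε : coeff ⟦ f , g ⟧ [] ≡ 0ℚ
  bracket-ε = begin
    coeff ⟦ f , g ⟧ []                                   ≡⟨ coeff-⟦⟧ f g [] ⟩
    coeff (f ⊛ g) [] + -1ℚ * coeff (g ⊛ f) []            ≡⟨ cong₂ (λ a b → a + -1ℚ * b) (coeff-⊛-[] f g) (coeff-⊛-[] g f) ⟩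
    coeff f [] * coeff g [] + -1ℚ * (coeff g [] * coeff f []) ≡⟨ cong₂ (λ a b → a + -1ℚ * b) (x≡0⇒x*y≡0 _ f₀) (x≡0⇒x*y≡0 _ g₀) ⟩
    0ℚ                                                   ∎
    where open ≡-Reasoning

  bracket-xx : ∀ s → coeff ⟦ f , g ⟧ (x^ suc (suc s)) ≡ 0ℚ
  bracket-xx s = begin
    coeff ⟦ f , g ⟧ (x^ suc (suc s))                                 ≡⟨ coeff-⟦⟧ f g (x^ suc (suc s)) ⟩
    coeff (f ⊛ g) (x^ suc (suc s)) + -1ℚ * coeff (g ⊛ f) (x^ suc (suc s))
      ≡⟨ cong₂ (λ a b → a + -1ℚ * b) (FG.coeff-⊛-x^suc (suc s) f) (GF.coeff-⊛-x^suc (suc s) g) ⟩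
    coeff f (x^ suc s) * cg + -1ℚ * (coeff g (x^ suc s) * cf)        ≡⟨ cases s ⟩
    0ℚ                                                                ∎
    where
    open ≡-Reasoning
    cases : ∀ s → coeff f (x^ suc s) * cg + -1ℚ * (coeff g (x^ suc s) * cf) ≡ 0ℚ
    cases zero = solve 2 (λ a b → a :* b :+ con -1ℚ :* (b :* a) := con 0ℚ) refl cf cg
    cases (suc s) = cong₂ (λ a b → a + -1ℚ * b) (x≡0⇒x*y≡0 cg (fxx s)) (x≡0⇒x*y≡0 cf (gxx s))

  expand : ∀ a b → xyx ⟦ f , g ⟧ a b ≡ (FG.leftX f a b + FG.rightX f a b) + -1ℚ * (GF.leftX g a b + GF.rightX g a b)
  expand a b = trans (coeff-⟦⟧ f g (x^ a ++ Y ∷ x^ b))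
    (cong₂ (λ z z′ → z + -1ℚ * z′) (FG.coeff-⊛-x^yx^ f f₀ fxx a b) (GF.coeff-⊛-x^yx^ g g₀ gxx a b))

  bracket-law : ∀ a b → xyx ⟦ f , g ⟧ a b ≡ sign b * binomial (a ℕ.+ b) b * xyx ⟦ f , g ⟧ (a ℕ.+ b) 0
  bracket-law a zero = xyx-law-0 ⟦ f , g ⟧ a
  bracket-law zero (suc b) = begin
    xyx ⟦ f , g ⟧ 0 (suc b)
      ≡⟨ expand 0 (suc b) ⟩
    (0ℚ + xyx f 0 b * cg) + -1ℚ * (0ℚ + xyx g 0 b * cf)
      ≡⟨ cong₂ (λ z z′ → (0ℚ + z * cg) + -1ℚ * (0ℚ + z′ * cf)) (fl 0 b) (gl 0 b) ⟩
    (0ℚ + sign b * binomial b b * xyx f b 0 * cg) + -1ℚ * (0ℚ + sign b * binomial b b * xyx g b 0 * cf)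
      ≡⟨ cong (λ c → (0ℚ + sign b * c * xyx f b 0 * cg) + -1ℚ * (0ℚ + sign b * c * xyx g b 0 * cf)) (binomial-n-n b) ⟩
    (0ℚ + sign b * 1ℚ * xyx f b 0 * cg) + -1ℚ * (0ℚ + sign b * 1ℚ * xyx g b 0 * cf)
      ≡⟨ bracket-law-edge cf cg (sign b) (xyx f b 0) (xyx g b 0) ⟩
    sign (suc b) * 1ℚ * ((cf * xyx g b 0 + 0ℚ) + -1ℚ * (cg * xyx f b 0 + 0ℚ))
      ≡⟨ cong₂ (λ c z → sign (suc b) * c * z) (binomial-n-n (suc b)) (expand (suc b) 0) ⟨
    sign (suc b) * binomial (suc b) (suc b) * xyx ⟦ f , g ⟧ (suc b) 0
      ∎
    where open ≡-Reasoning
  bracket-law (suc a) (suc b) = begin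
    xyx ⟦ f , g ⟧ (suc a) (suc b)
      ≡⟨ expand (suc a) (suc b) ⟩
    (cf * xyx g a (suc b) + xyx f (suc a) b * cg) + -1ℚ * (cg * xyx f a (suc b) + xyx g (suc a) b * cf)
      ≡⟨ cong₂ (λ z z′ → (cf * z + z′ * cg) + -1ℚ * (cg * xyx f a (suc b) + xyx g (suc a) b * cf)) (gl a (suc b)) (law-shift f fl) ⟩
    (cf * (sign (suc b) * C₂ * G) + (sign b * C₁ * F) * cg) + -1ℚ * (cg * xyx f a (suc b) + xyx g (suc a) b * cf)
      ≡⟨ cong₂ (λ z z′ → (cf * (sign (suc b) * C₂ * G) + (sign b * C₁ * F) * cg) + -1ℚ * (cg * z + z′ * cf)) (fl a (suc b)) (law-shift g gl) ⟩
    (cf * (sign (suc b) * C₂ * G) + (sign b * C₁ * F) * cg) + -1ℚ * (cg * (sign (suc b) * C₂ * F) + (sign b * C₁ * G) * cf)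
      ≡⟨ bracket-law-inner cf cg (sign b) C₁ C₂ F G ⟩
    sign (suc b) * (C₁ + C₂) * ((cf * G + 0ℚ) + -1ℚ * (cg * F + 0ℚ))
      ≡⟨ cong₂ (λ c z → sign (suc b) * c * z) (binomial-pascal N b) (expand (suc N) 0) ⟨
    sign (suc b) * binomial (suc N) (suc b) * xyx ⟦ f , g ⟧ (suc N) 0
      ∎
    where
    open ≡-Reasoning
    N = a ℕ.+ suc b
    C₁ = binomial N b
    C₂ = binomial N (suc b)
    F = xyx f N 0
    G = xyx g N 0
    law-shift : ∀ p → (∀ a b → xyx p a b ≡ sign b * binomial (a ℕ.+ b) b * xyx p (a ℕ.+ b) 0) →
                xyx p (suc a) b ≡ sign b * C₁ * xyx p N 0
    law-shift p law = trans (law (suc a) b) (cong (λ n → sign b * binomial n b * xyx p n 0) (sym (ℕP.+-suc a b)))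

countY-x^yx^ : ∀ a b → countY (x^ a ++ Y ∷ x^ b) ≡ 1
countY-x^yx^ a b = trans (countY-++ (x^ a) (Y ∷ x^ b)) (cong₂ ℕ._+_ (countY-x^ a) (cong suc (countY-x^ b)))

length-x^yx^ : ∀ a b → length (x^ a ++ Y ∷ x^ b) ≡ suc (a ℕ.+ b)
length-x^yx^ a b = trans (length-++ (x^ a)) (trans (cong₂ ℕ._+_ (length-replicate a) (cong suc (length-replicate b))) (ℕP.+-suc a b))

lieCoeffs-x : LieCoeffs (mono [ X ])
lieCoeffs-x = lieCoeffs refl (λ _ → refl) law
  where
  xyx≡0 : ∀ a b → xyx (mono [ X ]) a b ≡ 0ℚ
  xyx≡0 a b = trans (coeff-mono [ X ] (x^ a ++ Y ∷ x^ b))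
    (coeffTerm-≢ 1ℚ [ X ] (x^ a ++ Y ∷ x^ b) (λ e → ℕP.0≢1+n (trans (cong countY e) (countY-x^yx^ a b))))
  law : ∀ a b → xyx (mono [ X ]) a b ≡ sign b * binomial (a ℕ.+ b) b * xyx (mono [ X ]) (a ℕ.+ b) 0
  law a b = trans (xyx≡0 a b) (sym (y≡0⇒x*y≡0 (sign b * binomial (a ℕ.+ b) b) (xyx≡0 (a ℕ.+ b) 0)))

lieCoeffs-y : LieCoeffs (mono [ Y ])
lieCoeffs-y = lieCoeffs refl (λ _ → refl) law
  where
  xyx≡0 : ∀ a b → 0 < a ℕ.+ b → xyx (mono [ Y ]) a b ≡ 0ℚ
  xyx≡0 a b pos = trans (coeff-mono [ Y ] (x^ a ++ Y ∷ x^ b)) (coeffTerm-≢ 1ℚ [ Y ] (x^ a ++ Y ∷ x^ b)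
    (λ e → ℕP.<⇒≢ pos (ℕP.suc-injective (trans (cong length e) (length-x^yx^ a b)))))
  law : ∀ a b → xyx (mono [ Y ]) a b ≡ sign b * binomial (a ℕ.+ b) b * xyx (mono [ Y ]) (a ℕ.+ b) 0
  law a zero = xyx-law-0 (mono [ Y ]) a
  law a (suc b) = trans (xyx≡0 a (suc b) pos)
    (sym (y≡0⇒x*y≡0 (sign (suc b) * binomial (a ℕ.+ suc b) (suc b)) (xyx≡0 (a ℕ.+ suc b) 0 (subst (0 <_) (sym (ℕP.+-identityʳ _)) pos))))
    where
    pos : 0 < a ℕ.+ suc b
    pos = subst (0 <_) (sym (ℕP.+-suc a b)) (s≤s z≤n)

lieCoeffs-⊕ : ∀ p q → LieCoeffs p → LieCoeffs q → LieCoeffs (p ⊕ q)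
lieCoeffs-⊕ p q (lieCoeffs p₀ pxx pl) (lieCoeffs q₀ qxx ql) = lieCoeffs
  (trans (coeff-++ p q []) (cong₂ _+_ p₀ q₀))
  (λ s → trans (coeff-++ p q _) (cong₂ _+_ (pxx s) (qxx s)))
  law
  where
  law : ∀ a b → xyx (p ⊕ q) a b ≡ sign b * binomial (a ℕ.+ b) b * xyx (p ⊕ q) (a ℕ.+ b) 0
  law a b = begin
    xyx (p ⊕ q) a b               ≡⟨ coeff-++ p q _ ⟩
    xyx p a b + xyx q a b         ≡⟨ cong₂ _+_ (pl a b) (ql a b) ⟩
    c * xyx p n 0 + c * xyx q n 0 ≡⟨ ℚP.*-distribˡ-+ c _ _ ⟨
    c * (xyx p n 0 + xyx q n 0)   ≡⟨ cong (c *_) (coeff-++ p q _) ⟨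
    c * xyx (p ⊕ q) n 0           ∎
    where
    open ≡-Reasoning
    n = a ℕ.+ b
    c = sign b * binomial n b

lieCoeffs-• : ∀ c p → LieCoeffs p → LieCoeffs (c • p)
lieCoeffs-• c p (lieCoeffs p₀ pxx pl) = lieCoeffs
  (trans (coeff-• c p []) (y≡0⇒x*y≡0 c p₀))
  (λ s → trans (coeff-• c p _) (y≡0⇒x*y≡0 c (pxx s)))
  law
  where
  law : ∀ a b → xyx (c • p) a b ≡ sign b * binomial (a ℕ.+ b) b * xyx (c • p) (a ℕ.+ b) 0
  law a b = begin
    xyx (c • p) a b         ≡⟨ coeff-• c p _ ⟩
    c * xyx p a b           ≡⟨ cong (c *_) (pl a b) ⟩
    c * (s * xyx p n 0)     ≡⟨ solve 3 (λ c s P → c :* (s :* P) := s :* (c :* P)) refl c s (xyx p n 0) ⟩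
    s * (c * xyx p n 0)     ≡⟨ cong (s *_) (coeff-• c p _) ⟨
    s * xyx (c • p) n 0     ∎
    where
    open ≡-Reasoning
    n = a ℕ.+ b
    s = sign b * binomial n b

lieCoeffs-cong : ∀ p q → LieCoeffs p → p ≈ᶜ q → LieCoeffs q
lieCoeffs-cong p q (lieCoeffs p₀ pxx pl) p≈q = lieCoeffs
  (trans (sym (p≈q [])) p₀)
  (λ s → trans (sym (p≈q _)) (pxx s))
  (λ a b → trans (sym (p≈q _)) (trans (pl a b) (cong (sign b * binomial (a ℕ.+ b) b *_) (p≈q _))))

IsLie⇒LieCoeffs : ∀ {f} → IsLie f → LieCoeffs f
IsLie⇒LieCoeffs lie-x = lieCoeffs-x
IsLie⇒LieCoeffs lie-y = lieCoeffs-y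
IsLie⇒LieCoeffs (lie-add {f} {g} lf lg) = lieCoeffs-⊕ f g (IsLie⇒LieCoeffs lf) (IsLie⇒LieCoeffs lg)
IsLie⇒LieCoeffs (lie-scl {f} c lf) = lieCoeffs-• c f (IsLie⇒LieCoeffs lf)
IsLie⇒LieCoeffs (lie-brk {f} {g} lf lg) = lieCoeffs-⟦⟧ f g (IsLie⇒LieCoeffs lf) (IsLie⇒LieCoeffs lg)
IsLie⇒LieCoeffs (lie-eq {f} {g} lf f≈g) = lieCoeffs-cong f g (IsLie⇒LieCoeffs lf) f≈g

-- The entries of A

sign-+ : ∀ a b → sign (a ℕ.+ b) ≡ sign a * sign b
sign-+ zero b = sym (*-identityˡ _)
sign-+ (suc a) b = trans (cong (-1ℚ *_) (sign-+ a b)) (sym (ℚP.*-assoc -1ℚ (sign a) (sign b)))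

sign-even : ∀ n → sign (2 ℕ.* n) ≡ 1ℚ
sign-even n = begin
  sign (2 ℕ.* n)        ≡⟨ cong sign (double n) ⟩
  sign (n ℕ.+ n)        ≡⟨ sign-+ n n ⟩
  sign n * sign n       ≡⟨ square n ⟩
  1ℚ                    ∎
  where
  open ≡-Reasoning
  double : ∀ n → 2 ℕ.* n ≡ n ℕ.+ n
  double = solve-∀
  square : ∀ n → sign n * sign n ≡ 1ℚ
  square zero = refl
  square (suc n) = trans (solve 1 (λ s → (con -1ℚ :* s) :* (con -1ℚ :* s) := s :* s) refl (sign n)) (square n)

binomial-> : ∀ {n k} → n < k → binomial n k ≡ 0ℚ
binomial-> {n} {k} n<k = trans (binomial-def n k) (cong ℕtoℚ (k>n⇒nCk≡0 n<k))

δ : ℕ → ℕ → ℚ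
δ x y with x ℕ.≟ y
... | yes _ = 1ℚ
... | no _  = 0ℚ

δ-refl : ∀ x → δ x x ≡ 1ℚ
δ-refl x with x ℕ.≟ x
... | yes _ = refl
... | no x≢x = ⊥-elim (x≢x refl)

δ-≢ : ∀ {x y} → x ≢ y → δ x y ≡ 0ℚ
δ-≢ {x} {y} x≢y with x ℕ.≟ y
... | yes x≡y = ⊥-elim (x≢y x≡y)
... | no _    = refl

x^-+ : ∀ a b → x^ (a ℕ.+ b) ≡ x^ a ++ x^ b
x^-+ zero b = refl
x^-+ (suc a) b = cong (X ∷_) (x^-+ a b)

length-x^y : ∀ s → length (x^ s ++ [ Y ]) ≡ suc s
length-x^y s = trans (length-++ (x^ s)) (trans (cong (ℕ._+ 1) (length-replicate s)) (ℕP.+-comm s 1))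

-- For fa = f_(2J+1) and fb = f_(β+1) with 2I + 2P = 2J + β: the entry A_IJ at w_I = x^2I y x^2P y.
module EntryOfA (I J P β : ℕ) (degrees : 2 ℕ.* I ℕ.+ 2 ℕ.* P ≡ 2 ℕ.* J ℕ.+ β)
                (fa fb : Poly) (depth-fa : Depth≥ 1 fa)
                (law-fa : ∀ a b → xyx fa a b ≡ sign b * binomial (a ℕ.+ b) b * xyx fa (a ℕ.+ b) 0)
                (fa-lead : xyx fa (2 ℕ.* J) 0 ≡ 1ℚ) (hom-fb : Homogeneous (suc β) fb) (fb-lead : xyx fb β 0 ≡ 1ℚ) where

  W : Word
  W = x^ (2 ℕ.* I) ++ Y ∷ x^ (2 ℕ.* P) ++ [ Y ]

  -- w = (x^2I y x^2r)(x^β y) with 2I + 2r = 2J, and only the second factor fits fb.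
  coeff-product-≤ : I ≤ J → coeff (fa ⊛ fb) W ≡ binomial (2 ℕ.* J) (2 ℕ.* I)
  coeff-product-≤ I≤J = begin
    coeff (fa ⊛ fb) W
      ≡⟨ cong (coeff (fa ⊛ fb)) split ⟩
    coeff (fa ⊛ fb) (U ++ V)
      ≡⟨ coeff-⊛-split fb hom-fb U fa V (length-x^y β) ⟩
    coeff fa U * coeff fb V
      ≡⟨ cong₂ _*_ (law-fa (2 ℕ.* I) (2 ℕ.* r)) fb-lead ⟩
    sign (2 ℕ.* r) * binomial (2 ℕ.* I ℕ.+ 2 ℕ.* r) (2 ℕ.* r) * xyx fa (2 ℕ.* I ℕ.+ 2 ℕ.* r) 0 * 1ℚ
      ≡⟨ cong (λ n → sign (2 ℕ.* r) * binomial n (2 ℕ.* r) * xyx fa n 0 * 1ℚ) 2I+2r≡2J ⟩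
    sign (2 ℕ.* r) * binomial (2 ℕ.* J) (2 ℕ.* r) * xyx fa (2 ℕ.* J) 0 * 1ℚ
      ≡⟨ cong₂ (λ s c → s * binomial (2 ℕ.* J) (2 ℕ.* r) * c * 1ℚ) (sign-even r) fa-lead ⟩
    1ℚ * binomial (2 ℕ.* J) (2 ℕ.* r) * 1ℚ * 1ℚ
      ≡⟨ solve 1 (λ b → con 1ℚ :* b :* con 1ℚ :* con 1ℚ := b) refl (binomial (2 ℕ.* J) (2 ℕ.* r)) ⟩
    binomial (2 ℕ.* J) (2 ℕ.* r)
      ≡⟨ binomial-def _ _ ⟩
    ℕtoℚ ((2 ℕ.* J) C (2 ℕ.* r))
      ≡⟨ cong ℕtoℚ complement ⟨
    ℕtoℚ ((2 ℕ.* J) C (2 ℕ.* I))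
      ≡⟨ binomial-def _ _ ⟨
    binomial (2 ℕ.* J) (2 ℕ.* I)
      ∎
    where
    open ≡-Reasoning
    r = J ∸ I
    I+r≡J : I ℕ.+ r ≡ J
    I+r≡J = ℕP.m+[n∸m]≡n I≤J
    2I+2r≡2J : 2 ℕ.* I ℕ.+ 2 ℕ.* r ≡ 2 ℕ.* J
    2I+2r≡2J = trans (sym (ℕP.*-distribˡ-+ 2 I r)) (cong (2 ℕ.*_) I+r≡J)
    2P≡2r+β : 2 ℕ.* P ≡ 2 ℕ.* r ℕ.+ β
    2P≡2r+β = ℕP.+-cancelˡ-≡ (2 ℕ.* I) _ _
      (trans degrees (trans (cong (ℕ._+ β) (sym 2I+2r≡2J)) (ℕP.+-assoc (2 ℕ.* I) (2 ℕ.* r) β)))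
    U = x^ (2 ℕ.* I) ++ Y ∷ x^ (2 ℕ.* r)
    V = x^ β ++ [ Y ]
    split : W ≡ U ++ V
    split = begin
      x^ (2 ℕ.* I) ++ Y ∷ x^ (2 ℕ.* P) ++ [ Y ]          ≡⟨ cong (λ n → x^ (2 ℕ.* I) ++ Y ∷ x^ n ++ [ Y ]) 2P≡2r+β ⟩
      x^ (2 ℕ.* I) ++ Y ∷ x^ (2 ℕ.* r ℕ.+ β) ++ [ Y ]    ≡⟨ cong (λ v → x^ (2 ℕ.* I) ++ Y ∷ v ++ [ Y ]) (x^-+ (2 ℕ.* r) β) ⟩
      x^ (2 ℕ.* I) ++ Y ∷ (x^ (2 ℕ.* r) ++ x^ β) ++ [ Y ] ≡⟨ cong (λ v → x^ (2 ℕ.* I) ++ Y ∷ v) (++-assoc (x^ (2 ℕ.* r)) (x^ β) [ Y ]) ⟩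
      x^ (2 ℕ.* I) ++ Y ∷ x^ (2 ℕ.* r) ++ V              ≡⟨ ++-assoc (x^ (2 ℕ.* I)) (Y ∷ x^ (2 ℕ.* r)) V ⟨
      U ++ V                                             ∎
    complement : (2 ℕ.* J) C (2 ℕ.* I) ≡ (2 ℕ.* J) C (2 ℕ.* r)
    complement = trans (nCk≡nC[n∸k] (subst (2 ℕ.* I ≤_) 2I+2r≡2J (ℕP.m≤m+n _ _)))
                       (cong ((2 ℕ.* J) C_) (trans (cong (_∸ 2 ℕ.* I) (sym 2I+2r≡2J)) (ℕP.m+n∸m≡n (2 ℕ.* I) (2 ℕ.* r))))

  -- w = x^(2J+1) · v with v of degree β + 1, and fa has no coefficient on x^(2J+1).
  coeff-product-> : J < I → coeff (fa ⊛ fb) W ≡ binomial (2 ℕ.* J) (2 ℕ.* I)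
  coeff-product-> J<I = begin
    coeff (fa ⊛ fb) W          ≡⟨ cong (coeff (fa ⊛ fb)) split ⟩
    coeff (fa ⊛ fb) (U ++ V)   ≡⟨ coeff-⊛-split fb hom-fb U fa V length-V ⟩
    coeff fa U * coeff fb V    ≡⟨ x≡0⇒x*y≡0 (coeff fb V) (depth-fa U (subst (_< 1) (sym (countY-x^ (suc (2 ℕ.* J)))) (s≤s z≤n))) ⟩
    0ℚ                         ≡⟨ binomial-> 2J<2I ⟨
    binomial (2 ℕ.* J) (2 ℕ.* I) ∎
    where
    open ≡-Reasoning
    r = I ∸ suc J
    J+1+r≡I : suc J ℕ.+ r ≡ I
    J+1+r≡I = ℕP.m+[n∸m]≡n J<I
    2I≡ : 2 ℕ.* I ≡ suc (2 ℕ.* J) ℕ.+ suc (2 ℕ.* r)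
    2I≡ = trans (cong (2 ℕ.*_) (sym J+1+r≡I)) (ring J r)
      where
      ring : ∀ J r → 2 ℕ.* (suc J ℕ.+ r) ≡ suc (2 ℕ.* J) ℕ.+ suc (2 ℕ.* r)
      ring = solve-∀
    U = x^ suc (2 ℕ.* J)
    R = Y ∷ x^ (2 ℕ.* P) ++ [ Y ]
    V = x^ suc (2 ℕ.* r) ++ R
    split : W ≡ U ++ V
    split = trans (cong (λ n → x^ n ++ R) 2I≡)
                  (trans (cong (_++ R) (x^-+ (suc (2 ℕ.* J)) (suc (2 ℕ.* r)))) (++-assoc U (x^ suc (2 ℕ.* r)) R))
    length-V : length V ≡ suc β
    length-V = ℕP.+-cancelˡ-≡ (2 ℕ.* J) _ _ (begin
      2 ℕ.* J ℕ.+ length V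
        ≡⟨ cong (2 ℕ.* J ℕ.+_) (trans (length-++ (x^ suc (2 ℕ.* r)))
             (cong₂ ℕ._+_ (length-replicate (suc (2 ℕ.* r))) (cong suc (length-x^y (2 ℕ.* P))))) ⟩
      2 ℕ.* J ℕ.+ (suc (2 ℕ.* r) ℕ.+ suc (suc (2 ℕ.* P)))
        ≡⟨ ring J r P ⟩
      suc (2 ℕ.* (suc J ℕ.+ r) ℕ.+ 2 ℕ.* P)
        ≡⟨ cong (λ i → suc (2 ℕ.* i ℕ.+ 2 ℕ.* P)) J+1+r≡I ⟩
      suc (2 ℕ.* I ℕ.+ 2 ℕ.* P)
        ≡⟨ cong suc degrees ⟩
      suc (2 ℕ.* J ℕ.+ β)
        ≡⟨ ℕP.+-suc (2 ℕ.* J) β ⟨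
      2 ℕ.* J ℕ.+ suc β
        ∎)
      where
      ring : ∀ J r P → 2 ℕ.* J ℕ.+ (suc (2 ℕ.* r) ℕ.+ suc (suc (2 ℕ.* P))) ≡ suc (2 ℕ.* (suc J ℕ.+ r) ℕ.+ 2 ℕ.* P)
      ring = solve-∀
    2J<2I : 2 ℕ.* J < 2 ℕ.* I
    2J<2I = subst (suc (2 ℕ.* J) ≤_) (sym 2I≡) (ℕP.m≤m+n (suc (2 ℕ.* J)) (suc (2 ℕ.* r)))

  coeff-product : coeff (fa ⊛ fb) W ≡ binomial (2 ℕ.* J) (2 ℕ.* I)
  coeff-product with I ℕ.≤? J
  ... | yes I≤J = coeff-product-≤ I≤J
  ... | no I≰J = coeff-product-> (ℕP.≰⇒> I≰J)

  open DerivationCoeff fa depth-fa (2 ℕ.* P)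

  fb-x^y≡0 : ∀ s → s ≢ β → coeff fb (x^ s ++ [ Y ]) ≡ 0ℚ
  fb-x^y≡0 s s≢β = coeff-off-degree fb hom-fb (x^ s ++ [ Y ]) (λ e → s≢β (ℕP.suc-injective (trans (sym (length-x^y s)) e)))

  derCoeff-∂x^-zero : ∀ t → t ≢ β → derCoeff (∂x^ t fb) 0 ≡ 0ℚ
  derCoeff-∂x^-zero t t≢β = begin
    derCoeff (∂x^ t fb) 0           ≡⟨ derCoeff-zero (∂x^ t fb) ⟩
    A * c + -1ℚ * (B * c)           ≡⟨ cong (λ c → A * c + -1ℚ * (B * c)) (trans (coeff-∂x^ t fb [ Y ]) (fb-x^y≡0 t t≢β)) ⟩
    A * 0ℚ + -1ℚ * (B * 0ℚ)         ≡⟨ solve 2 (λ A B → A :* con 0ℚ :+ con -1ℚ :* (B :* con 0ℚ) := con 0ℚ) refl A B ⟩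
    0ℚ                              ∎
    where
    open ≡-Reasoning
    A = coeff fa (x^ (2 ℕ.* P) ++ [ Y ])
    B = coeff fa (Y ∷ x^ (2 ℕ.* P))
    c = coeff (∂x^ t fb) [ Y ]

  coeff-derivation-< : 2 ℕ.* I < β → coeff (Der fa fb) W ≡ δ (2 ℕ.* I) β + -1ℚ * binomial (2 ℕ.* J) (2 ℕ.* P)
  coeff-derivation-< 2I<β = begin
    coeff (Der fa fb) W
      ≡⟨ derCoeff-skip (2 ℕ.* I) fb (λ s s<2I → fb-x^y≡0 s (ℕP.<⇒≢ (ℕP.<-trans s<2I 2I<β))) ⟩
    derCoeff (∂x^ (2 ℕ.* I) fb) 0
      ≡⟨ derCoeff-∂x^-zero (2 ℕ.* I) (ℕP.<⇒≢ 2I<β) ⟩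
    0ℚ + -1ℚ * 0ℚ
      ≡⟨ cong₂ (λ a b → a + -1ℚ * b) (δ-≢ (ℕP.<⇒≢ 2I<β)) (binomial-> 2J<2P) ⟨
    δ (2 ℕ.* I) β + -1ℚ * binomial (2 ℕ.* J) (2 ℕ.* P)
      ∎
    where
    open ≡-Reasoning
    2J<2P : 2 ℕ.* J < 2 ℕ.* P
    2J<2P = ℕP.≰⇒> (λ 2P≤2J → ℕP.<-irrefl (trans degrees (ℕP.+-comm (2 ℕ.* J) β)) (ℕP.+-mono-<-≤ 2I<β 2P≤2J))

  coeff-derivation-≡ : 2 ℕ.* I ≡ β → coeff (Der fa fb) W ≡ δ (2 ℕ.* I) β + -1ℚ * binomial (2 ℕ.* J) (2 ℕ.* P)
  coeff-derivation-≡ 2I≡β = begin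
    coeff (Der fa fb) W
      ≡⟨ derCoeff-skip (2 ℕ.* I) fb (λ s s<2I → fb-x^y≡0 s (λ s≡β → ℕP.<-irrefl (trans s≡β (sym 2I≡β)) s<2I)) ⟩
    derCoeff (∂x^ (2 ℕ.* I) fb) 0
      ≡⟨ derCoeff-zero (∂x^ (2 ℕ.* I) fb) ⟩
    xyx fa K 0 * c + -1ℚ * (xyx fa 0 K * c)
      ≡⟨ cong₂ (λ a b → a * c + -1ℚ * (b * c)) fa-lead′ (law-fa 0 K) ⟩
    1ℚ * c + -1ℚ * (sign K * binomial K K * xyx fa K 0 * c)
      ≡⟨ cong₂ (λ s b → 1ℚ * c + -1ℚ * (s * binomial K K * b * c)) (sign-even P) fa-lead′ ⟩
    1ℚ * c + -1ℚ * (1ℚ * binomial K K * 1ℚ * c)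
      ≡⟨ cong₂ (λ c b → 1ℚ * c + -1ℚ * (1ℚ * b * 1ℚ * c)) c≡1 (binomial-n-n K) ⟩
    1ℚ * 1ℚ + -1ℚ * (1ℚ * 1ℚ * 1ℚ * 1ℚ)
      ≡⟨ cong₂ (λ d b → d + -1ℚ * b) (trans (cong (λ i → δ i β) 2I≡β) (δ-refl β))
                                      (trans (cong (λ n → binomial n K) (sym 2P≡2J)) (binomial-n-n K)) ⟨
    δ (2 ℕ.* I) β + -1ℚ * binomial (2 ℕ.* J) (2 ℕ.* P)
      ∎
    where
    open ≡-Reasoning
    K = 2 ℕ.* P
    c = coeff (∂x^ (2 ℕ.* I) fb) [ Y ]
    c≡1 : c ≡ 1ℚ
    c≡1 = trans (coeff-∂x^ (2 ℕ.* I) fb [ Y ]) (trans (cong (λ n → xyx fb n 0) 2I≡β) fb-lead)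
    2P≡2J : K ≡ 2 ℕ.* J
    2P≡2J = ℕP.+-cancelˡ-≡ β _ _ (trans (trans (cong (ℕ._+ K) (sym 2I≡β)) degrees) (ℕP.+-comm (2 ℕ.* J) β))
    fa-lead′ : xyx fa K 0 ≡ 1ℚ
    fa-lead′ = trans (cong (λ n → xyx fa n 0) 2P≡2J) fa-lead

  coeff-derivation-> : β < 2 ℕ.* I → coeff (Der fa fb) W ≡ δ (2 ℕ.* I) β + -1ℚ * binomial (2 ℕ.* J) (2 ℕ.* P)
  coeff-derivation-> β<2I = begin
    coeff (Der fa fb) W
      ≡⟨ cong (derCoeff fb) β+1+d≡2I ⟨
    derCoeff fb (β ℕ.+ suc d)
      ≡⟨ derCoeff-skip-past d β fb (λ s s≢β _ → fb-x^y≡0 s s≢β) ⟩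
    derCoeff (∂x^ (β ℕ.+ suc d) fb) 0 + -1ℚ * (xyx fa (suc d) K * xyx fb β 0)
      ≡⟨ cong₂ (λ a b → a + -1ℚ * (b * xyx fb β 0)) (derCoeff-∂x^-zero (β ℕ.+ suc d) (ℕP.m+1+n≢m β)) (law-fa (suc d) K) ⟩
    0ℚ + -1ℚ * (sign K * binomial (suc d ℕ.+ K) K * xyx fa (suc d ℕ.+ K) 0 * xyx fb β 0)
      ≡⟨ cong (λ n → 0ℚ + -1ℚ * (sign K * binomial n K * xyx fa n 0 * xyx fb β 0)) d+1+2P≡2J ⟩
    0ℚ + -1ℚ * (sign K * binomial (2 ℕ.* J) K * xyx fa (2 ℕ.* J) 0 * xyx fb β 0)
      ≡⟨ cong₂ (λ s a → 0ℚ + -1ℚ * (s * binomial (2 ℕ.* J) K * a * xyx fb β 0)) (sign-even P) fa-lead ⟩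
    0ℚ + -1ℚ * (1ℚ * binomial (2 ℕ.* J) K * 1ℚ * xyx fb β 0)
      ≡⟨ cong (λ b → 0ℚ + -1ℚ * (1ℚ * binomial (2 ℕ.* J) K * 1ℚ * b)) fb-lead ⟩
    0ℚ + -1ℚ * (1ℚ * binomial (2 ℕ.* J) K * 1ℚ * 1ℚ)
      ≡⟨ solve 1 (λ b → con 0ℚ :+ con -1ℚ :* (con 1ℚ :* b :* con 1ℚ :* con 1ℚ) := con 0ℚ :+ con -1ℚ :* b) refl (binomial (2 ℕ.* J) K) ⟩
    0ℚ + -1ℚ * binomial (2 ℕ.* J) K
      ≡⟨ cong (_+ -1ℚ * binomial (2 ℕ.* J) K) (δ-≢ (ℕP.>⇒≢ β<2I)) ⟨
    δ (2 ℕ.* I) β + -1ℚ * binomial (2 ℕ.* J) (2 ℕ.* P)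
      ∎
    where
    open ≡-Reasoning
    K = 2 ℕ.* P
    d = 2 ℕ.* I ∸ suc β
    β+1+d≡2I : β ℕ.+ suc d ≡ 2 ℕ.* I
    β+1+d≡2I = trans (ℕP.+-suc β d) (ℕP.m+[n∸m]≡n β<2I)
    d+1+2P≡2J : suc d ℕ.+ K ≡ 2 ℕ.* J
    d+1+2P≡2J = ℕP.+-cancelˡ-≡ β _ _
      (trans (sym (ℕP.+-assoc β (suc d) K)) (trans (cong (ℕ._+ K) β+1+d≡2I) (trans degrees (ℕP.+-comm (2 ℕ.* J) β))))

  coeff-derivation : coeff (Der fa fb) W ≡ δ (2 ℕ.* I) β + -1ℚ * binomial (2 ℕ.* J) (2 ℕ.* P)
  coeff-derivation with ℕP.<-cmp (2 ℕ.* I) β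
  ... | tri< 2I<β _ _ = coeff-derivation-< 2I<β
  ... | tri≈ _ 2I≡β _ = coeff-derivation-≡ 2I≡β
  ... | tri> _ _ β<2I = coeff-derivation-> β<2I

  coeff-g : coeff ((fa ⊛ fb) ⊕ Der fa fb) W
          ≡ binomial (2 ℕ.* J) (2 ℕ.* I) + (δ (2 ℕ.* I) β + -1ℚ * binomial (2 ℕ.* J) (2 ℕ.* P))
  coeff-g = trans (coeff-++ (fa ⊛ fb) (Der fa fb) W) (cong₂ _+_ coeff-product coeff-derivation)

-- Symmetry of ᵗA D B

nCk*k!*[n∸k]!≡n! : ∀ {n k} → k ≤ n → (n C k) ℕ.* (k ! ℕ.* (n ∸ k) !) ≡ n !
nCk*k!*[n∸k]!≡n! {n} {k} k≤n =
  trans (cong (ℕ._* (k ! ℕ.* (n ∸ k) !)) (nCk≡n!/k![n-k]! k≤n)) (m/n*n≡m {{k !* (n ∸ k) !≢0}} (k![n∸k]!∣n! k≤n))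

-- Both sides count the ways of splitting N objects into blocks of sizes N ∸ x, x + y ∸ N and N ∸ y.
nCy*yC[n∸x]≡nCx*xC[n∸y] : ∀ N x y → x ≤ N → y ≤ N → (N C y) ℕ.* (y C (N ∸ x)) ≡ (N C x) ℕ.* (x C (N ∸ y))
nCy*yC[n∸x]≡nCx*xC[n∸y] N x y x≤N y≤N with (N ∸ x) ℕ.≤? y
... | no a≰y = trans (vanishes (N C y) (k>n⇒nCk≡0 (ℕP.≰⇒> a≰y))) (sym (vanishes (N C x) (k>n⇒nCk≡0 x<b)))
  where
  vanishes : ∀ m {n} → n ≡ 0 → m ℕ.* n ≡ 0
  vanishes m refl = ℕP.*-zeroʳ m
  a = N ∸ x
  b = N ∸ y
  x<b : x < b
  x<b = ℕP.≰⇒> (λ b≤x → a≰y (ℕP.+-cancelˡ-≤ x a y (begin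
    x ℕ.+ a   ≡⟨ ℕP.m+[n∸m]≡n x≤N ⟩
    N         ≡⟨ ℕP.m+[n∸m]≡n y≤N ⟨
    y ℕ.+ b   ≤⟨ ℕP.+-monoʳ-≤ y b≤x ⟩
    y ℕ.+ x   ≡⟨ ℕP.+-comm y x ⟩
    x ℕ.+ y   ∎)))
    where open ℕP.≤-Reasoning
... | yes a≤y = ℕP.*-cancelʳ-≡ _ _ Q {{Q≢0}} (trans (left≡N!) (sym right≡N!))
  where
  a = N ∸ x
  b = N ∸ y
  e = y ∸ a
  a+e≡y : a ℕ.+ e ≡ y
  a+e≡y = ℕP.m+[n∸m]≡n a≤y
  e+b≡x : e ℕ.+ b ≡ x
  e+b≡x = ℕP.+-cancelʳ-≡ a _ _ (begin
    e ℕ.+ b ℕ.+ a     ≡⟨ ℕP.+-comm (e ℕ.+ b) a ⟩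
    a ℕ.+ (e ℕ.+ b)   ≡⟨ ℕP.+-assoc a e b ⟨
    a ℕ.+ e ℕ.+ b     ≡⟨ cong (ℕ._+ b) a+e≡y ⟩
    y ℕ.+ b           ≡⟨ ℕP.m+[n∸m]≡n y≤N ⟩
    N                 ≡⟨ ℕP.m+[n∸m]≡n x≤N ⟨
    x ℕ.+ a           ∎)
    where open ≡-Reasoning
  b≤x : b ≤ x
  b≤x = subst (b ≤_) e+b≡x (ℕP.m≤n+m b e)
  x∸b≡e : x ∸ b ≡ e
  x∸b≡e = trans (cong (_∸ b) (sym e+b≡x)) (ℕP.m+n∸n≡m e b)
  Q = a ! ℕ.* e ! ℕ.* b !
  Q≢0 : ℕ.NonZero Q
  Q≢0 = ℕP.m*n≢0 (a ! ℕ.* e !) (b !) {{a !* e !≢0}} {{b !≢0}}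
  left≡N! : (N C y) ℕ.* (y C a) ℕ.* Q ≡ N !
  left≡N! = trans (ring (N C y) (y C a) (a !) (e !) (b !))
                  (trans (cong (λ z → (N C y) ℕ.* (z ℕ.* b !)) (nCk*k!*[n∸k]!≡n! a≤y)) (nCk*k!*[n∸k]!≡n! y≤N))
    where
    ring : ∀ p q r s t → p ℕ.* q ℕ.* (r ℕ.* s ℕ.* t) ≡ p ℕ.* ((q ℕ.* (r ℕ.* s)) ℕ.* t)
    ring = solve-∀
  right≡N! : (N C x) ℕ.* (x C b) ℕ.* Q ≡ N !
  right≡N! = trans (ring (N C x) (x C b) (a !) (e !) (b !))
                   (trans (cong (λ z → (N C x) ℕ.* (z ℕ.* a !)) xCb*b!*e!≡x!) (nCk*k!*[n∸k]!≡n! x≤N))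
    where
    ring : ∀ p q r s t → p ℕ.* q ℕ.* (r ℕ.* s ℕ.* t) ≡ p ℕ.* ((q ℕ.* (t ℕ.* s)) ℕ.* r)
    ring = solve-∀
    xCb*b!*e!≡x! : (x C b) ℕ.* (b ! ℕ.* e !) ≡ x !
    xCb*b!*e!≡x! = trans (cong (λ z → (x C b) ℕ.* (b ! ℕ.* z !)) (sym x∸b≡e)) (nCk*k!*[n∸k]!≡n! b≤x)

ΣF-cong : ∀ {m} {f g : Fin m → ℚ} → (∀ i → f i ≡ g i) → ΣF f ≡ ΣF g
ΣF-cong {zero} f≗g = refl
ΣF-cong {suc m} f≗g = cong₂ _+_ (f≗g Fin.zero) (ΣF-cong (λ i → f≗g (Fin.suc i)))

ΣF-+ : ∀ {m} (f g : Fin m → ℚ) → ΣF (λ i → f i + g i) ≡ ΣF f + ΣF g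
ΣF-+ {zero} f g = refl
ΣF-+ {suc m} f g = trans (cong (f Fin.zero + g Fin.zero +_) (ΣF-+ (λ i → f (Fin.suc i)) (λ i → g (Fin.suc i))))
  (solve 4 (λ a b c d → a :+ b :+ (c :+ d) := a :+ c :+ (b :+ d)) refl
    (f Fin.zero) (g Fin.zero) (ΣF (λ i → f (Fin.suc i))) (ΣF (λ i → g (Fin.suc i))))

ΣF-zero : ∀ {m} (f : Fin m → ℚ) → (∀ i → f i ≡ 0ℚ) → ΣF f ≡ 0ℚ
ΣF-zero {zero} f f≗0 = refl
ΣF-zero {suc m} f f≗0 = cong₂ _+_ (f≗0 Fin.zero) (ΣF-zero (λ i → f (Fin.suc i)) (λ i → f≗0 (Fin.suc i)))

ΣF-single : ∀ {m} (f : Fin m → ℚ) l → (∀ p → p ≢ l → f p ≡ 0ℚ) → ΣF f ≡ f l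
ΣF-single {suc m} f Fin.zero f≗0 =
  trans (cong (f Fin.zero +_) (ΣF-zero (λ i → f (Fin.suc i)) (λ i → f≗0 (Fin.suc i) (λ ())))) (+-identityʳ _)
ΣF-single {suc m} f (Fin.suc l) f≗0 =
  trans (cong₂ _+_ (f≗0 Fin.zero (λ ())) (ΣF-single (λ i → f (Fin.suc i)) l (λ p p≢l → f≗0 (Fin.suc p) (λ e → p≢l (FinP.suc-injective e)))))
        (+-identityˡ _)

ΣF-last : ∀ {m} (f : Fin (suc m) → ℚ) → ΣF f ≡ ΣF (λ i → f (Fin.inject₁ i)) + f (Fin.fromℕ m)
ΣF-last {zero} f = trans (+-identityʳ (f Fin.zero)) (sym (+-identityˡ (f Fin.zero)))
ΣF-last {suc m} f = trans (cong (f Fin.zero +_) (ΣF-last (λ i → f (Fin.suc i)))) (sym (ℚP.+-assoc (f Fin.zero) _ _))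

ΣF-reverse : ∀ {m} (f : Fin m → ℚ) → ΣF f ≡ ΣF (λ i → f (Fin.opposite i))
ΣF-reverse {zero} f = refl
ΣF-reverse {suc m} f =
  trans (ΣF-last f) (trans (cong (_+ f (Fin.fromℕ m)) (ΣF-reverse (λ i → f (Fin.inject₁ i)))) (ℚP.+-comm _ (f (Fin.fromℕ m))))

inverse-unique : ∀ x y c → x * c ≡ 1ℚ → y * c ≡ 1ℚ → x ≡ y
inverse-unique x y c xc≡1 yc≡1 = begin
  x              ≡⟨ *-identityʳ x ⟨
  x * 1ℚ         ≡⟨ cong (x *_) yc≡1 ⟨
  x * (y * c)    ≡⟨ solve 3 (λ x y c → x :* (y :* c) := y :* (x :* c)) refl x y c ⟩
  y * (x * c)    ≡⟨ cong (y *_) xc≡1 ⟩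
  y * 1ℚ         ≡⟨ *-identityʳ y ⟩
  y              ∎
  where open ≡-Reasoning

cross-multiply : ∀ x y c d a b → x * c ≡ 1ℚ → y * d ≡ 1ℚ → d * a ≡ c * b → x * a ≡ y * b
cross-multiply x y c d a b xc≡1 yd≡1 da≡cb = begin
  x * a                ≡⟨ *-identityʳ _ ⟨
  x * a * 1ℚ           ≡⟨ cong (x * a *_) yd≡1 ⟨
  x * a * (y * d)      ≡⟨ solve 4 (λ x y d a → x :* a :* (y :* d) := x :* y :* (d :* a)) refl x y d a ⟩
  x * y * (d * a)      ≡⟨ cong (x * y *_) da≡cb ⟩
  x * y * (c * b)      ≡⟨ solve 4 (λ x y c b → x :* y :* (c :* b) := y :* b :* (x :* c)) refl x y c b ⟩
  y * b * (x * c)      ≡⟨ cong (y * b *_) xc≡1 ⟩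
  y * b * 1ℚ           ≡⟨ *-identityʳ _ ⟩
  y * b                ∎
  where open ≡-Reasoning

idx : ∀ {m} → Fin m → ℕ
idx i = suc (toℕ i)

idx≤ : ∀ {m} (i : Fin m) → idx i ≤ suc m
idx≤ {m} i = ℕP.≤-trans (toℕ<n i) (ℕP.n≤1+n m)

module SymmetricProduct (m : ℕ) (D A : Matrix m)
  (D-diag : ∀ l → D l l * binomial (2 ℕ.* suc m) (2 ℕ.* idx l) ≡ 1ℚ)
  (D-off : ∀ p l → p ≢ l → D p l ≡ 0ℚ)
  (A-entry : ∀ l i → A l i ≡ binomial (2 ℕ.* idx i) (2 ℕ.* idx l)
                              + (δ (2 ℕ.* idx l) (2 ℕ.* (suc m ∸ idx i)) + -1ℚ * binomial (2 ℕ.* idx i) (2 ℕ.* (suc m ∸ idx l))))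
  where

  private
    M = suc m
    N = 2 ℕ.* M

    d : Fin m → ℚ
    d l = D l l

    b : ℕ → ℕ → ℚ
    b x y = binomial (2 ℕ.* x) (2 ℕ.* y)

    c : ℕ → ℚ
    c L = binomial N (2 ℕ.* L)

  idx-opposite : ∀ l → idx (Fin.opposite l) ≡ M ∸ idx l
  idx-opposite l = trans (cong suc (FinP.opposite-prop l)) (sym (ℕP.+-∸-assoc 1 (toℕ<n l)))

  M∸idx-opposite : ∀ l → M ∸ idx (Fin.opposite l) ≡ idx l
  M∸idx-opposite l = trans (cong (M ∸_) (idx-opposite l)) (ℕP.m∸[m∸n]≡n (idx≤ l))

  2[M∸L]≡N∸2L : ∀ L → 2 ℕ.* (M ∸ L) ≡ N ∸ 2 ℕ.* L
  2[M∸L]≡N∸2L L = ℕP.*-distribˡ-∸ 2 M L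

  c-complement : ∀ L → L ≤ M → c (M ∸ L) ≡ c L
  c-complement L L≤M = begin
    binomial N (2 ℕ.* (M ∸ L))     ≡⟨ cong (binomial N) (2[M∸L]≡N∸2L L) ⟩
    binomial N (N ∸ 2 ℕ.* L)       ≡⟨ binomial-def N _ ⟩
    ℕtoℚ (N C (N ∸ 2 ℕ.* L))       ≡⟨ cong ℕtoℚ (nCk≡nC[n∸k] (ℕP.*-monoʳ-≤ 2 L≤M)) ⟨
    ℕtoℚ (N C (2 ℕ.* L))           ≡⟨ binomial-def N _ ⟨
    binomial N (2 ℕ.* L)           ∎
    where open ≡-Reasoning

  d-opposite-inverse : ∀ l → d (Fin.opposite l) * c (idx l) ≡ 1ℚ
  d-opposite-inverse l =
    trans (cong (d (Fin.opposite l) *_) (sym (trans (cong c (idx-opposite l)) (c-complement (idx l) (idx≤ l)))))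
          (D-diag (Fin.opposite l))

  d-opposite : ∀ l → d (Fin.opposite l) ≡ d l
  d-opposite l = inverse-unique (d (Fin.opposite l)) (d l) (c (idx l)) (d-opposite-inverse l) (D-diag l)

  binomial-term δ-term reflected-term : Fin m → Fin m → Fin m → ℚ
  binomial-term i j l = b (idx i) (idx l) * (d l * b (idx j) (idx l))
  δ-term i j l = δ (2 ℕ.* idx l) (2 ℕ.* (M ∸ idx i)) * (d l * b (idx j) (idx l))
  reflected-term i j l = -1ℚ * (b (idx i) (M ∸ idx l) * (d l * b (idx j) (idx l)))

  product-entry : ∀ i j → ((transpose A ·M D) ·M matB m) i j
                        ≡ ΣF (binomial-term i j) + (ΣF (δ-term i j) + ΣF (reflected-term i j))
  product-entry i j = trans (ΣF-cong term) (trans (ΣF-+ (binomial-term i j) _) (cong (ΣF (binomial-term i j) +_) (ΣF-+ (δ-term i j) _)))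
    where
    diagonal : ∀ l → (transpose A ·M D) i l ≡ A l i * d l
    diagonal l = ΣF-single (λ p → A p i * D p l) l (λ p p≢l → y≡0⇒x*y≡0 (A p i) (D-off p l p≢l))
    term : ∀ l → (transpose A ·M D) i l * matB m l j ≡ binomial-term i j l + (δ-term i j l + reflected-term i j l)
    term l = trans (cong₂ _*_ (trans (diagonal l) (cong (_* d l) (A-entry l i))) (sym (binomial-def (2 ℕ.* idx j) (2 ℕ.* idx l))))
      (solve 5 (λ B₁ dl B₃ δ′ Bj → (B₁ :+ (δ′ :+ con -1ℚ :* B₃)) :* dl :* Bj
                                    := B₁ :* (dl :* Bj) :+ (δ′ :* (dl :* Bj) :+ con -1ℚ :* (B₃ :* (dl :* Bj)))) refl
        (b (idx i) (idx l)) (d l) (b (idx i) (M ∸ idx l)) (δ (2 ℕ.* idx l) (2 ℕ.* (M ∸ idx i))) (b (idx j) (idx l)))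

  binomial-part-symmetric : ∀ i j → ΣF (binomial-term i j) ≡ ΣF (binomial-term j i)
  binomial-part-symmetric i j = ΣF-cong (λ l →
    solve 3 (λ p dl q → p :* (dl :* q) := q :* (dl :* p)) refl (b (idx i) (idx l)) (d l) (b (idx j) (idx l)))

  -- Reindexing l ↦ M - l swaps the roles of i and j, since d is invariant under it.
  reflected-part-symmetric : ∀ i j → ΣF (reflected-term i j) ≡ ΣF (reflected-term j i)
  reflected-part-symmetric i j = trans (ΣF-reverse (reflected-term i j)) (ΣF-cong reflect)
    where
    reflect : ∀ l → reflected-term i j (Fin.opposite l) ≡ reflected-term j i l
    reflect l = begin
      -1ℚ * (b (idx i) (M ∸ idx l′) * (d l′ * b (idx j) (idx l′)))
        ≡⟨ cong₂ (λ x y → -1ℚ * (b (idx i) x * (d l′ * b (idx j) y))) (M∸idx-opposite l) (idx-opposite l) ⟩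
      -1ℚ * (b (idx i) (idx l) * (d l′ * b (idx j) (M ∸ idx l)))
        ≡⟨ cong (λ z → -1ℚ * (b (idx i) (idx l) * (z * b (idx j) (M ∸ idx l)))) (d-opposite l) ⟩
      -1ℚ * (b (idx i) (idx l) * (d l * b (idx j) (M ∸ idx l)))
        ≡⟨ solve 3 (λ p dl q → con -1ℚ :* (p :* (dl :* q)) := con -1ℚ :* (q :* (dl :* p))) refl (b (idx i) (idx l)) (d l) (b (idx j) (M ∸ idx l)) ⟩
      -1ℚ * (b (idx j) (M ∸ idx l) * (d l * b (idx i) (idx l)))
        ∎
      where
      open ≡-Reasoning
      l′ = Fin.opposite l

  δ-part : ∀ i j → ΣF (δ-term i j) ≡ d (Fin.opposite i) * b (idx j) (M ∸ idx i)
  δ-part i j = begin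
    ΣF (δ-term i j)
      ≡⟨ ΣF-single (δ-term i j) i′ off ⟩
    δ (2 ℕ.* idx i′) (2 ℕ.* (M ∸ idx i)) * (d i′ * b (idx j) (idx i′))
      ≡⟨ cong (λ n → δ (2 ℕ.* n) (2 ℕ.* (M ∸ idx i)) * (d i′ * b (idx j) n)) (idx-opposite i) ⟩
    δ (2 ℕ.* (M ∸ idx i)) (2 ℕ.* (M ∸ idx i)) * (d i′ * b (idx j) (M ∸ idx i))
      ≡⟨ cong (_* (d i′ * b (idx j) (M ∸ idx i))) (δ-refl (2 ℕ.* (M ∸ idx i))) ⟩
    1ℚ * (d i′ * b (idx j) (M ∸ idx i))
      ≡⟨ *-identityˡ _ ⟩
    d i′ * b (idx j) (M ∸ idx i)
      ∎
    where
    open ≡-Reasoning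
    i′ = Fin.opposite i
    off : ∀ p → p ≢ i′ → δ-term i j p ≡ 0ℚ
    off p p≢i′ = x≡0⇒x*y≡0 (d p * b (idx j) (idx p)) (δ-≢ (λ e → p≢i′ (toℕ-injective (ℕP.suc-injective
      (trans (ℕP.*-cancelˡ-≡ (idx p) (M ∸ idx i) 2 e) (sym (idx-opposite i)))))))

  -- With d (M - i) = 1 / c i, symmetry of the δ-part is the identity
  -- c j · binom(2j, N - 2i) = c i · binom(2i, N - 2j).
  δ-part-symmetric : ∀ i j → ΣF (δ-term i j) ≡ ΣF (δ-term j i)
  δ-part-symmetric i j = trans (δ-part i j) (trans (cross-multiply (d (Fin.opposite i)) (d (Fin.opposite j)) (c (idx i)) (c (idx j))
      (b (idx j) (M ∸ idx i)) (b (idx i) (M ∸ idx j)) (d-opposite-inverse i) (d-opposite-inverse j) trinomial) (sym (δ-part j i)))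
    where
    2idx≤N : ∀ x → 2 ℕ.* idx x ≤ N
    2idx≤N x = ℕP.*-monoʳ-≤ 2 (idx≤ x)
    trinomial : c (idx j) * b (idx j) (M ∸ idx i) ≡ c (idx i) * b (idx i) (M ∸ idx j)
    trinomial = begin
      c (idx j) * b (idx j) (M ∸ idx i)
        ≡⟨ cong₂ _*_ (binomial-def N (2 ℕ.* idx j)) (binomial-def (2 ℕ.* idx j) _) ⟩
      ℕtoℚ (N C (2 ℕ.* idx j)) * ℕtoℚ ((2 ℕ.* idx j) C (2 ℕ.* (M ∸ idx i)))
        ≡⟨ ℕtoℚ-* (N C (2 ℕ.* idx j)) _ ⟨
      ℕtoℚ ((N C (2 ℕ.* idx j)) ℕ.* ((2 ℕ.* idx j) C (2 ℕ.* (M ∸ idx i))))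
        ≡⟨ cong ℕtoℚ (begin
             (N C (2 ℕ.* idx j)) ℕ.* ((2 ℕ.* idx j) C (2 ℕ.* (M ∸ idx i)))
               ≡⟨ cong (λ z → (N C (2 ℕ.* idx j)) ℕ.* ((2 ℕ.* idx j) C z)) (2[M∸L]≡N∸2L (idx i)) ⟩
             (N C (2 ℕ.* idx j)) ℕ.* ((2 ℕ.* idx j) C (N ∸ 2 ℕ.* idx i))
               ≡⟨ nCy*yC[n∸x]≡nCx*xC[n∸y] N (2 ℕ.* idx i) (2 ℕ.* idx j) (2idx≤N i) (2idx≤N j) ⟩
             (N C (2 ℕ.* idx i)) ℕ.* ((2 ℕ.* idx i) C (N ∸ 2 ℕ.* idx j))
               ≡⟨ cong (λ z → (N C (2 ℕ.* idx i)) ℕ.* ((2 ℕ.* idx i) C z)) (2[M∸L]≡N∸2L (idx j)) ⟨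
             (N C (2 ℕ.* idx i)) ℕ.* ((2 ℕ.* idx i) C (2 ℕ.* (M ∸ idx j)))
               ∎) ⟩
      ℕtoℚ ((N C (2 ℕ.* idx i)) ℕ.* ((2 ℕ.* idx i) C (2 ℕ.* (M ∸ idx j))))
        ≡⟨ ℕtoℚ-* (N C (2 ℕ.* idx i)) _ ⟩
      ℕtoℚ (N C (2 ℕ.* idx i)) * ℕtoℚ ((2 ℕ.* idx i) C (2 ℕ.* (M ∸ idx j)))
        ≡⟨ cong₂ _*_ (binomial-def N (2 ℕ.* idx i)) (binomial-def (2 ℕ.* idx i) _) ⟨
      c (idx i) * b (idx i) (M ∸ idx j)
        ∎
      where open ≡-Reasoning

  symmetric : IsSymmetric ((transpose A ·M D) ·M matB m)
  symmetric i j = begin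
    ((transpose A ·M D) ·M matB m) i j
      ≡⟨ product-entry i j ⟩
    ΣF (binomial-term i j) + (ΣF (δ-term i j) + ΣF (reflected-term i j))
      ≡⟨ cong₂ _+_ (binomial-part-symmetric i j) (cong₂ _+_ (δ-part-symmetric i j) (reflected-part-symmetric i j)) ⟩
    ΣF (binomial-term j i) + (ΣF (δ-term j i) + ΣF (reflected-term j i))
      ≡⟨ product-entry j i ⟨
    ((transpose A ·M D) ·M matB m) j i
      ∎
    where open ≡-Reasoning

diag-≡ : ∀ {m} (c : Fin m → ℚ) l → diag c l l ≡ c l
diag-≡ c l with toℕ l ℕ.≟ toℕ l
... | yes _ = refl
... | no l≢l = ⊥-elim (l≢l refl)

diag-≢ : ∀ {m} (c : Fin m → ℚ) p l → p ≢ l → diag c p l ≡ 0ℚ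
diag-≢ c p l p≢l with toℕ p ℕ.≟ toℕ l
... | yes e = ⊥-elim (p≢l (toℕ-injective e))
... | no _ = refl

identity-≡ : ∀ {m} (l : Fin m) → identity l l ≡ 1ℚ
identity-≡ l with toℕ l ℕ.≟ toℕ l
... | yes _ = refl
... | no l≢l = ⊥-elim (l≢l refl)

identity-≢ : ∀ {m} (p l : Fin m) → p ≢ l → identity p l ≡ 0ℚ
identity-≢ p l p≢l with toℕ p ℕ.≟ toℕ l
... | yes e = ⊥-elim (p≢l (toℕ-injective e))
... | no _ = refl

module InverseOfDiag {m} (D : Matrix m) (c : Fin m → ℚ) (D·diag≡I : ∀ i j → (D ·M diag c) i j ≡ identity i j) where

  D·diag : ∀ p l → (D ·M diag c) p l ≡ D p l * c l
  D·diag p l = trans (ΣF-single (λ r → D p r * diag c r l) l (λ r r≢l → y≡0⇒x*y≡0 (D p r) (diag-≢ c r l r≢l)))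
                     (cong (D p l *_) (diag-≡ c l))

  diagonal-inverse : ∀ l → D l l * c l ≡ 1ℚ
  diagonal-inverse l = trans (sym (D·diag l l)) (trans (D·diag≡I l l) (identity-≡ l))

  off-diagonal : ∀ p l → p ≢ l → D p l ≡ 0ℚ
  off-diagonal p l p≢l = begin
    D p l                      ≡⟨ *-identityʳ _ ⟨
    D p l * 1ℚ                 ≡⟨ cong (D p l *_) (diagonal-inverse l) ⟨
    D p l * (D l l * c l)      ≡⟨ solve 3 (λ a b x → a :* (b :* x) := (a :* x) :* b) refl (D p l) (D l l) (c l) ⟩
    (D p l * c l) * D l l      ≡⟨ cong (_* D l l) (trans (sym (D·diag p l)) (trans (D·diag≡I p l) (identity-≢ p l p≢l))) ⟩
    0ℚ * D l l                 ≡⟨ *-zeroˡ (D l l) ⟩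
    0ℚ                         ∎
    where open ≡-Reasoning

HasDepth1⇒Depth≥1 : ∀ f → HasDepth 1 f → Depth≥ 1 f
HasDepth1⇒Depth≥1 f (_ , minimal) u lt = off-support (coeff f u) (minimal u) (ℕP.<⇒≱ lt)

2n+1-odd : ∀ n → (2 ℕ.* n ℕ.+ 1) % 2 ≡ 1
2n+1-odd n = trans (cong (_% 2) (ring n)) ([m+kn]%n≡m%n 1 n 2)
  where
  ring : ∀ n → 2 ℕ.* n ℕ.+ 1 ≡ 1 ℕ.+ n ℕ.* 2
  ring = solve-∀

even-k : ∀ k → 12 ≤ k → k % 2 ≡ 0 → k ≡ 2 ℕ.* suc ((k ∸ 4) / 2) ℕ.+ 2
even-k k 12≤k k-even = begin
  k                      ≡⟨ ℕP.m∸n+n≡m 4≤k ⟨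
  n ℕ.+ 4                ≡⟨ cong (ℕ._+ 4) n≡m*2 ⟩
  m ℕ.* 2 ℕ.+ 4          ≡⟨ ring m ⟩
  2 ℕ.* suc m ℕ.+ 2      ∎
  where
  open ≡-Reasoning
  n = k ∸ 4
  m = n / 2
  4≤k : 4 ≤ k
  4≤k = ℕP.≤-trans (s≤s (s≤s (s≤s (s≤s z≤n)))) 12≤k
  n-even : n % 2 ≡ 0
  n-even = trans (sym ([m+kn]%n≡m%n n 2 2)) (trans (cong (_% 2) (ℕP.m∸n+n≡m 4≤k)) k-even)
  n≡m*2 : n ≡ m ℕ.* 2
  n≡m*2 = trans (m≡m%n+[m/n]*n n 2) (cong (ℕ._+ m ℕ.* 2) n-even)
  ring : ∀ m → m ℕ.* 2 ℕ.+ 4 ≡ 2 ℕ.* suc m ℕ.+ 2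
  ring = solve-∀

Generator : ℕ → Poly → Set
Generator n fn = InDs n fn × HasDepth 1 fn × coeff fn (xpowy n) ≡ 1ℚ

module EntriesOfA (k m : ℕ) (k≡ : k ≡ 2 ℕ.* suc m ℕ.+ 2) (f : ℕ → Poly)
                  (generators : ∀ n → 3 ≤ n → n % 2 ≡ 1 → Generator n (f n)) where

  private
    M = suc m

  2x+2[M∸x]≡2M : ∀ x → x ≤ M → 2 ℕ.* x ℕ.+ 2 ℕ.* (M ∸ x) ≡ 2 ℕ.* M
  2x+2[M∸x]≡2M x x≤M = trans (sym (ℕP.*-distribˡ-+ 2 x (M ∸ x))) (cong (2 ℕ.*_) (ℕP.m+[n∸m]≡n x≤M))

  k∸2x≡ : ∀ x → x ≤ M → k ∸ 2 ℕ.* x ≡ 2 ℕ.* (M ∸ x) ℕ.+ 2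
  k∸2x≡ x x≤M = begin
    k ∸ 2 ℕ.* x                                       ≡⟨ cong (_∸ 2 ℕ.* x) k≡ ⟩
    2 ℕ.* M ℕ.+ 2 ∸ 2 ℕ.* x                           ≡⟨ cong (λ n → n ℕ.+ 2 ∸ 2 ℕ.* x) (2x+2[M∸x]≡2M x x≤M) ⟨
    2 ℕ.* x ℕ.+ 2 ℕ.* (M ∸ x) ℕ.+ 2 ∸ 2 ℕ.* x         ≡⟨ cong (_∸ 2 ℕ.* x) (ℕP.+-assoc (2 ℕ.* x) (2 ℕ.* (M ∸ x)) 2) ⟩
    2 ℕ.* x ℕ.+ (2 ℕ.* (M ∸ x) ℕ.+ 2) ∸ 2 ℕ.* x       ≡⟨ ℕP.m+n∸m≡n (2 ℕ.* x) _ ⟩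
    2 ℕ.* (M ∸ x) ℕ.+ 2                               ∎
    where open ≡-Reasoning

  k∸2≡2M : k ∸ 2 ≡ 2 ℕ.* M
  k∸2≡2M = trans (cong (_∸ 2) k≡) (ℕP.m+n∸n≡m (2 ℕ.* M) 2)

  matA-entry : ∀ l i → matA f k m l i ≡ binomial (2 ℕ.* idx i) (2 ℕ.* idx l)
                     + (δ (2 ℕ.* idx l) (2 ℕ.* (M ∸ idx i)) + -1ℚ * binomial (2 ℕ.* idx i) (2 ℕ.* (M ∸ idx l)))
  matA-entry l i = trans (cong (coeff (g f k J)) word) (EntryOfA.coeff-g I J P β degrees fa fb depth-fa law-fa fa-lead hom-fb fb-lead)
    where
    I = idx l
    J = idx i
    P = M ∸ I
    β = 2 ℕ.* (M ∸ J)
    degrees : 2 ℕ.* I ℕ.+ 2 ℕ.* P ≡ 2 ℕ.* J ℕ.+ β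
    degrees = trans (2x+2[M∸x]≡2M I (idx≤ l)) (sym (2x+2[M∸x]≡2M J (idx≤ i)))
    word : w k I ≡ x^ (2 ℕ.* I) ++ Y ∷ x^ (2 ℕ.* P) ++ [ Y ]
    word = cong (λ n → x^ (2 ℕ.* I) ++ Y ∷ x^ n ++ [ Y ])
                (trans (cong (_∸ 2) (k∸2x≡ I (idx≤ l))) (ℕP.m+n∸n≡m (2 ℕ.* P) 2))

    a = 2 ℕ.* J ℕ.+ 1
    fa = f a
    gen-a : Generator a fa
    gen-a = generators a (ℕP.+-monoˡ-≤ 1 (ℕP.*-monoʳ-≤ 2 (s≤s z≤n))) (2n+1-odd J)
    depth-fa : Depth≥ 1 fa
    depth-fa = HasDepth1⇒Depth≥1 fa (proj₁ (proj₂ gen-a))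
    law-fa : ∀ a b → xyx fa a b ≡ sign b * binomial (a ℕ.+ b) b * xyx fa (a ℕ.+ b) 0
    law-fa = LieCoeffs.xyx-law (IsLie⇒LieCoeffs (proj₁ (proj₁ gen-a)))
    fa-lead : xyx fa (2 ℕ.* J) 0 ≡ 1ℚ
    fa-lead = trans (cong (λ n → coeff fa (x^ n ++ [ Y ])) (sym (ℕP.m+n∸n≡m (2 ℕ.* J) 1))) (proj₂ (proj₂ gen-a))

    b = k ∸ 2 ℕ.* J ∸ 1
    fb = f b
    b≡β+1 : b ≡ suc β
    b≡β+1 = cong (_∸ 1) (trans (k∸2x≡ J (idx≤ i)) (ℕP.+-comm β 2))
    gen-b : Generator b fb
    gen-b = generators b (subst (3 ≤_) (sym b≡β+1) (s≤s (ℕP.*-monoʳ-≤ 2 (ℕP.m<n⇒0<n∸m (s≤s (toℕ<n i))))))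
                         (subst (λ n → n % 2 ≡ 1) (sym b≡β+1) (trans (cong (_% 2) (ℕP.+-comm 1 β)) (2n+1-odd (M ∸ J))))
    hom-fb : Homogeneous (suc β) fb
    hom-fb = subst (λ n → Homogeneous n fb) b≡β+1 (proj₁ (proj₂ (proj₁ gen-b)))
    fb-lead : xyx fb β 0 ≡ 1ℚ
    fb-lead = trans (cong (λ n → coeff fb (xpowy n)) (sym b≡β+1)) (proj₂ (proj₂ gen-b))

  Dinv-diagonal : ∀ (l : Fin m) → ℕtoℚ ((k ∸ 2) C (2 ℕ.* suc (toℕ l))) ≡ binomial (2 ℕ.* M) (2 ℕ.* idx l)
  Dinv-diagonal l = trans (cong (λ n → ℕtoℚ (n C (2 ℕ.* idx l))) k∸2≡2M) (sym (binomial-def _ _))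

proposition3p3 : (k : ℕ) → 12 ≤ k → k % 2 ≡ 0 →
    (f : ℕ → Poly) →
    (∀ n → 3 ≤ n → n % 2 ≡ 1 →
       InDs n (f n) × HasDepth 1 (f n) × coeff (f n) (xpowy n) ≡ 1ℚ) →
    (D : Matrix ((k ∸ 4) / 2)) →
    (∀ i j → (D ·M matDinv k ((k ∸ 4) / 2)) i j ≡ identity i j) →
    IsSymmetric ((transpose (matA f k ((k ∸ 4) / 2)) ·M D) ·M matB ((k ∸ 4) / 2))
proposition3p3 k 12≤k k-even f generators D D·Dinv≡I =
  SymmetricProduct.symmetric m D (matA f k m) D-diagonal DInv.off-diagonal Entries.matA-entry
  where
  m = (k ∸ 4) / 2
  module DInv = InverseOfDiag D (λ l → ℕtoℚ ((k ∸ 2) C (2 ℕ.* suc (toℕ l)))) D·Dinv≡I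
  module Entries = EntriesOfA k m (even-k k 12≤k k-even) f generators
  D-diagonal : ∀ l → D l l * binomial (2 ℕ.* suc m) (2 ℕ.* idx l) ≡ 1ℚ
  D-diagonal l = trans (cong (D l l *_) (sym (Entries.Dinv-diagonal l))) (DInv.diagonal-inverse l)
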